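{- For each integer $m\ge2$ there exists a planar latin bitrade $(W,B)$ of size $8m$ such that if $W$ embeds in an abelian group $G$, then $G$ has torsion rank at least $\log_2(m+1)$.
   Context: A latin bitrade is a pair $(W,B)$ of non-empty finite sets of triples (row, column, symbol), any two distinct triples in the same set agreeing in at most one coordinate, such that for each $(x,y,z)\in W$ (resp. $B$) there exist unique $x'\ne x$, $y'\ne y$, $z'\ne z$ with $(x',y,z),(x,y',z),(x,y,z')\in B$ (resp. $W$). Its size is $|W|$. It is connected if it is not the union of two latin bitrades $(W',B')$, $(W'',B'')$ with $W'\cap W''=\emptyset$. With $R,C,S$ the pairwise disjoint sets of rows, columns, symbols used: for each row $x$ let $\psi_x(z)=z'$ iff $(x,y,z)\in W$, $(x,y,z')\in B$ for some $y$, with analogous permutations for columns and symbols; the bitrade is separated if all are single cycles. It is planar if separated, connected and $2+|W|-|R|-|C|-|S|=0$. $W$ embeds in an abelian group $G$ if there are injections $f:R\to G$, $h:C\to G$, $k:S\to G$ with $f(x)+h(y)=k(z)$ for all $(x,y,z)\in W$. The torsion rank of an abelian group is the minimum cardinality of a generating set of its torsion subgroup. -}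

module Defs where

open import Level using (Level; Setω)
open import Data.Nat using (ℕ; zero; suc; _+_; _≤_; _^_)
open import Data.Nat.Properties using (_≟_)
open import Data.Integer using (ℤ; +_; -[1+_])
open import Data.Fin using (Fin)
open import Data.Vec using (Vec; []; _∷_; lookup)
open import Data.Product using (Σ; _×_; _,_; proj₁; proj₂)
open import Data.Sum using (_⊎_)
open import Data.Empty using (⊥)
open import Data.List using (List; []; _∷_; map; deduplicate; _++_; length)
open import Data.List.Membership.Propositional using (_∈_)
open import Data.List.Relation.Unary.Unique.Propositional using (Unique)
open import Relation.Nullary using (¬_)
open import Relation.Binary.PropositionalEquality using (_≡_; _≢_)
open import Algebra.Bundles using (AbelianGroup)

-- Triples (row, column, symbol).  Rows, columns and symbols are labelled
-- by natural numbers; they live in separate coordinates, so the sets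
-- R, C, S are (tagged, hence) pairwise disjoint.

Triple : Set
Triple = ℕ × ℕ × ℕ

rowOf colOf symOf : Triple → ℕ
rowOf (x , y , z) = x
colOf (x , y , z) = y
symOf (x , y , z) = z

ExactlyOne : (ℕ → Set) → Set
ExactlyOne P = Σ ℕ λ a → P a × (∀ b → P b → a ≡ b)

NonEmpty : List Triple → Set
NonEmpty T = Σ Triple λ t → t ∈ T

AgreeTwo : Triple → Triple → Set
AgreeTwo (x , y , z) (x' , y' , z') =
  (x ≡ x' × y ≡ y') ⊎ (x ≡ x' × z ≡ z') ⊎ (y ≡ y' × z ≡ z')

PartialLatin : List Triple → Set
PartialLatin T = ∀ {t t'} → t ∈ T → t' ∈ T → AgreeTwo t t' → t ≡ t'

Mates : List Triple → List Triple → Set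
Mates T U = ∀ {x y z} → (x , y , z) ∈ T →
  ExactlyOne (λ x' → x' ≢ x × (x' , y , z) ∈ U) ×
  ExactlyOne (λ y' → y' ≢ y × (x , y' , z) ∈ U) ×
  ExactlyOne (λ z' → z' ≢ z × (x , y , z') ∈ U)

-- (W , B) is a latin bitrade (finite sets represented by duplicate-free lists)
LatinBitrade : List Triple → List Triple → Set
LatinBitrade W B =
  NonEmpty W × NonEmpty B × Unique W × Unique B ×
  PartialLatin W × PartialLatin B × Mates W B × Mates B W

size : List Triple → ℕ
size W = length W

SameSet : List Triple → List Triple → Set
SameSet A A' = ∀ t → (t ∈ A → t ∈ A') × (t ∈ A' → t ∈ A)

Disjoint : List Triple → List Triple → Set
Disjoint A A' = ∀ t → t ∈ A → t ∈ A' → ⊥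

Connected : List Triple → List Triple → Set
Connected W B = ¬ (Σ (List Triple) λ W' → Σ (List Triple) λ B' →
                   Σ (List Triple) λ W'' → Σ (List Triple) λ B'' →
  LatinBitrade W' B' × LatinBitrade W'' B'' × Disjoint W' W'' ×
  SameSet W (W' ++ W'') × SameSet B (B' ++ B''))

Rows Cols Syms : List Triple → List ℕ
Rows W = deduplicate _≟_ (map rowOf W)
Cols W = deduplicate _≟_ (map colOf W)
Syms W = deduplicate _≟_ (map symOf W)

Steps : (ℕ → ℕ → Set) → ℕ → ℕ → ℕ → Set
Steps S zero a b = a ≡ b
Steps S (suc n) a b = Σ ℕ λ c → S a c × Steps S n c b

SingleCycle : (ℕ → Set) → (ℕ → ℕ → Set) → Set
SingleCycle D S = ∀ a b → D a → D b → Σ ℕ λ n → Steps S n a b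

rowDom : List Triple → ℕ → ℕ → Set
rowDom W x z = Σ ℕ λ y → (x , y , z) ∈ W
rowPerm : List Triple → List Triple → ℕ → ℕ → ℕ → Set
rowPerm W B x z z' = Σ ℕ λ y → (x , y , z) ∈ W × (x , y , z') ∈ B

colDom : List Triple → ℕ → ℕ → Set
colDom W y x = Σ ℕ λ z → (x , y , z) ∈ W
colPerm : List Triple → List Triple → ℕ → ℕ → ℕ → Set
colPerm W B y x x' = Σ ℕ λ z → (x , y , z) ∈ W × (x' , y , z) ∈ B

symDom : List Triple → ℕ → ℕ → Set
symDom W z y = Σ ℕ λ x → (x , y , z) ∈ W
symPerm : List Triple → List Triple → ℕ → ℕ → ℕ → Set
symPerm W B z y y' = Σ ℕ λ x → (x , y , z) ∈ W × (x , y' , z) ∈ B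

Separated : List Triple → List Triple → Set
Separated W B =
  (∀ x → x ∈ Rows W → SingleCycle (rowDom W x) (rowPerm W B x)) ×
  (∀ y → y ∈ Cols W → SingleCycle (colDom W y) (colPerm W B y)) ×
  (∀ z → z ∈ Syms W → SingleCycle (symDom W z) (symPerm W B z))

Planar : List Triple → List Triple → Set
Planar W B = Separated W B × Connected W B ×
  2 + size W ≡ length (Rows W) + length (Cols W) + length (Syms W)

module _ {c ℓ : Level} (G : AbelianGroup c ℓ) where
  open AbelianGroup G

  natMul : ℕ → Carrier → Carrier
  natMul zero g = ε
  natMul (suc n) g = g ∙ natMul n g

  intMul : ℤ → Carrier → Carrier
  intMul (+ n) g = natMul n g
  intMul -[1+ n ] g = (natMul (suc n) g) ⁻¹

  linComb : ∀ {k} → Vec ℤ k → Vec Carrier k → Carrier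
  linComb [] [] = ε
  linComb (a ∷ as) (g ∷ gs) = intMul a g ∙ linComb as gs

  IsTorsion : Carrier → Set ℓ
  IsTorsion g = Σ ℕ λ n → natMul (suc n) g ≈ ε

  GeneratesTorsion : ∀ {k} → Vec Carrier k → Set (c Level.⊔ ℓ)
  GeneratesTorsion {k} gs =
    ((i : Fin k) → IsTorsion (lookup gs i)) ×
    (∀ t → IsTorsion t → Σ (Vec ℤ k) λ as → linComb as gs ≈ t)

  -- torsion rank ≥ log₂ N : every generating set of the torsion
  -- subgroup of cardinality k satisfies k ≥ log₂ N, i.e. N ≤ 2^k
  -- (torsion subgroups that are not finitely generated have infinite rank)
  TorsionRankAtLeastLog₂ : ℕ → Set (c Level.⊔ ℓ)
  TorsionRankAtLeastLog₂ N =
    ∀ k (gs : Vec Carrier k) → GeneratesTorsion gs → N ≤ 2 ^ k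

  EmbedsIn : List Triple → Set (c Level.⊔ ℓ)
  EmbedsIn W = Σ (ℕ → Carrier) λ f → Σ (ℕ → Carrier) λ h → Σ (ℕ → Carrier) λ k →
    (∀ x x' → x ∈ Rows W → x' ∈ Rows W → f x ≈ f x' → x ≡ x') ×
    (∀ y y' → y ∈ Cols W → y' ∈ Cols W → h y ≈ h y' → y ≡ y') ×
    (∀ z z' → z ∈ Syms W → z' ∈ Syms W → k z ≈ k z' → z ≡ z') ×
    (∀ x y z → (x , y , z) ∈ W → (f x ∙ h y) ≈ k z)

EmbeddingForcesTorsionRank : List Triple → ℕ → Setω
EmbeddingForcesTorsionRank W N =
  ∀ {c ℓ} (G : AbelianGroup c ℓ) → EmbedsIn G W → TorsionRankAtLeastLog₂ G N

-- Σ and × into Setω (needed since the group quantifier ranges over all levels)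


record Σω (A : Set) (P : A → Setω) : Setω where
  constructor _,ω_
  field
    witness : A
    property : P witness

record _×ω_ (A : Set) (B : Setω) : Setω where
  constructor _,ω'_
  field
    fstω : A
    sndω : B

module Submission where

-- (1) Group theory (TwoTorsion): if the torsion subgroup of an abelian group
--     is generated by k elements, it has at most 2^k elements t with 2t = 0.
--     By induction on k: enlarging a subgroup Z to Z + ⟨g⟩ merges such
--     classes at most two at a time, because ⟨g⟩ / (⟨g⟩ ∩ Z) is cyclic and so
--     has at most one element of order two (Classical).  The argument is
--     classical, but its conclusion is decidable, hence constructive.
-- (2) Construction: for m = n + 2, m blocks of eight white and eight black
--     cells on abstract labels, encoded into ℕ.  Latin property, mates,
--     separation (every line permutation is a 2-, 4- or m-cycle, see Cycles
--     and CyclicOrder), connectivity and Euler's count 2 + 8m = 2(m+1) + 3m + 3m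
--     (Counting) are checked on labels and carried along the encoding.
-- (3) For an embedding (f, h, k) of W the elements 0 and f(A j) - f(P) are
--     m + 1 distinct elements of order at most two, so m + 1 ≤ 2^k by (1).

open import Defs
open import Data.Nat using (ℕ; _≤_; _*_; suc)
open import Data.Product using (_×_)
open import Data.List using (List)
open import Relation.Binary.PropositionalEquality using (_≡_)
open import Data.Nat using (z≤n; s≤s)
open import Data.Product using (_,_)

module CyclicOrder where
  open import Data.Nat using (zero; suc)
  open import Data.Fin using (Fin; zero; suc; fromℕ; inject₁)
  open import Data.Fin.Properties using (fromℕ≢inject₁; suc-injective)
  open import Data.Fin.Induction using (<-weakInduction; >-weakInduction)
  open import Data.Maybe using (Maybe; just; nothing; fromMaybe)
  import Data.Maybe as Maybe
  open import Relation.Binary.Construct.Closure.ReflexiveTransitive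
    using (Star; ε; _◅_; _◅◅_; reverse)
  open import Relation.Binary.PropositionalEquality
    using (_≡_; _≢_; refl; sym; trans; cong)

  successor? : ∀ {k} → Fin (suc k) → Maybe (Fin (suc k))
  successor? {zero}  zero    = nothing
  successor? {suc k} zero    = just (suc zero)
  successor? {suc k} (suc i) = Maybe.map suc (successor? i)

  next : ∀ {k} → Fin (suc k) → Fin (suc k)
  next i = fromMaybe zero (successor? i)

  prev : ∀ {k} → Fin (suc k) → Fin (suc k)
  prev {k} zero    = fromℕ k
  prev     (suc i) = inject₁ i

  next-inject₁ : ∀ {k} (i : Fin k) → next (inject₁ i) ≡ suc i
  next-inject₁ i = cong (fromMaybe zero) (successor?-inject₁ i)
    where
    successor?-inject₁ : ∀ {k} (i : Fin k) → successor? (inject₁ i) ≡ just (suc i)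
    successor?-inject₁ {suc k} zero    = refl
    successor?-inject₁ {suc k} (suc i) = cong (Maybe.map suc) (successor?-inject₁ i)

  next-last : ∀ k → next (fromℕ k) ≡ zero
  next-last k = cong (fromMaybe zero) (successor?-last k)
    where
    successor?-last : ∀ k → successor? (fromℕ k) ≡ nothing
    successor?-last zero    = refl
    successor?-last (suc k) = cong (Maybe.map suc) (successor?-last k)

  data LastOrInjected : ∀ {k} → Fin (suc k) → Set where
    last     : ∀ {k} → LastOrInjected (fromℕ k)
    injected : ∀ {k} (i : Fin k) → LastOrInjected (inject₁ i)

  lastOrInjected : ∀ {k} (j : Fin (suc k)) → LastOrInjected j
  lastOrInjected {zero}  zero    = last
  lastOrInjected {suc k} zero    = injected zero
  lastOrInjected {suc k} (suc j) with lastOrInjected j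
  ... | last       = last
  ... | injected i = injected (suc i)

  prev-next : ∀ {k} (j : Fin (suc k)) → prev (next j) ≡ j
  prev-next j with lastOrInjected j
  ... | last {k}   = cong prev (next-last k)
  ... | injected i = cong prev (next-inject₁ i)

  next-prev : ∀ {k} (j : Fin (suc k)) → next (prev j) ≡ j
  next-prev {k} zero    = next-last k
  next-prev     (suc i) = next-inject₁ i

  next≢ : ∀ {k} (j : Fin (suc (suc k))) → next j ≢ j
  next≢ j with lastOrInjected j
  ... | last {k}   = λ e → fromℕ≢inject₁ {i = zero} (sym (trans (sym (next-last k)) e))
  ... | injected i = λ e → suc≢inject₁ i (trans (sym (next-inject₁ i)) e)
    where
    suc≢inject₁ : ∀ {k} (i : Fin k) → suc i ≢ inject₁ i
    suc≢inject₁ zero    ()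
    suc≢inject₁ (suc i) e = suc≢inject₁ i (suc-injective e)

  Graph : ∀ {A : Set} → (A → A) → A → A → Set
  Graph f a b = f a ≡ b

  next-connected : ∀ {k} (a b : Fin (suc k)) → Star (Graph next) a b
  next-connected {k} a b = toZero a ◅◅ fromZero b
    where
    fromZero : ∀ j → Star (Graph next) zero j
    fromZero = <-weakInduction (Star (Graph next) zero) ε
      (λ i path → path ◅◅ (next-inject₁ i ◅ ε))
    toZero : ∀ j → Star (Graph next) j zero
    toZero = >-weakInduction (λ j → Star (Graph next) j zero) (next-last k ◅ ε)
      (λ i path → next-inject₁ i ◅ path)

  prev-connected : ∀ {k} (a b : Fin (suc k)) → Star (Graph prev) a b
  prev-connected a b = reverse (λ {i} e → trans (cong prev (sym e)) (prev-next i)) (next-connected b a)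

module Cycles where
  open CyclicOrder using (Graph)
  open import Data.Nat using (ℕ; suc)
  open import Data.Product using (Σ; _×_; _,_)
  open import Data.Sum using (_⊎_; inj₁; inj₂)
  open import Relation.Binary.Construct.Closure.ReflexiveTransitive
    using (Star; ε; _◅_; _◅◅_; kleisliStar; gmap)
  open import Relation.Binary.PropositionalEquality using (_≡_; refl)

  CycleOn : {X : Set} → (X → Set) → (X → X → Set) → Set
  CycleOn Dom St = ∀ a b → Dom a → Dom b → Star St a b

  viaHub : {X : Set} {Dom : X → Set} {St : X → X → Set} (h : X) →
           (∀ a → Dom a → Star St a h) → (∀ b → Dom b → Star St h b) → CycleOn Dom St
  viaHub h toHub fromHub a b da db = toHub a da ◅◅ fromHub b db

  twoCycle : {X : Set} {Dom : X → Set} {St : X → X → Set} (x y : X) → St x y → St y x →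
             (∀ z → Dom z → z ≡ x ⊎ z ≡ y) → CycleOn Dom St
  twoCycle x y xy yx covers = viaHub x
    (λ z dz → to z (covers z dz)) (λ z dz → from z (covers z dz))
    where
    to : ∀ z → z ≡ x ⊎ z ≡ y → Star _ z x
    to z (inj₁ refl) = ε
    to z (inj₂ refl) = yx ◅ ε
    from : ∀ z → z ≡ x ⊎ z ≡ y → Star _ x z
    from z (inj₁ refl) = ε
    from z (inj₂ refl) = xy ◅ ε

  fourCycle : {X : Set} {Dom : X → Set} {St : X → X → Set} (x₀ x₁ x₂ x₃ : X) →
              St x₀ x₁ → St x₁ x₂ → St x₂ x₃ → St x₃ x₀ →
              (∀ z → Dom z → z ≡ x₀ ⊎ z ≡ x₁ ⊎ z ≡ x₂ ⊎ z ≡ x₃) → CycleOn Dom St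
  fourCycle x₀ x₁ x₂ x₃ s₀ s₁ s₂ s₃ covers = viaHub x₀
    (λ z dz → to z (covers z dz)) (λ z dz → from z (covers z dz))
    where
    to : ∀ z → z ≡ x₀ ⊎ z ≡ x₁ ⊎ z ≡ x₂ ⊎ z ≡ x₃ → Star _ z x₀
    to z (inj₁ refl)                 = ε
    to z (inj₂ (inj₁ refl))          = s₁ ◅ s₂ ◅ s₃ ◅ ε
    to z (inj₂ (inj₂ (inj₁ refl)))   = s₂ ◅ s₃ ◅ ε
    to z (inj₂ (inj₂ (inj₂ refl)))   = s₃ ◅ ε
    from : ∀ z → z ≡ x₀ ⊎ z ≡ x₁ ⊎ z ≡ x₂ ⊎ z ≡ x₃ → Star _ x₀ z
    from z (inj₁ refl)               = ε
    from z (inj₂ (inj₁ refl))        = s₀ ◅ ε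
    from z (inj₂ (inj₂ (inj₁ refl))) = s₀ ◅ s₁ ◅ ε
    from z (inj₂ (inj₂ (inj₂ refl))) = s₀ ◅ s₁ ◅ s₂ ◅ ε

  threadedCycle : {X I : Set} {Dom : X → Set} {St : X → X → Set} (f : I → I) (base : I → X) →
    (∀ i j → Star (Graph f) i j) → (i₀ : I) →
    (∀ j → Star St (base j) (base (f j))) →
    (∀ a → Dom a → Σ I λ j → Star St a (base j)) →
    (∀ b → Dom b → Σ I λ j → Star St (base j) b) → CycleOn Dom St
  threadedCycle {St = St} f base connected i₀ chain into outOf = viaHub (base i₀)
    (λ a da → let (j , path) = into a da in path ◅◅ lift (connected j i₀))
    (λ b db → let (j , path) = outOf b db in lift (connected i₀ j) ◅◅ path)
    where
    lift : ∀ {i j} → Star (Graph f) i j → Star St (base i) (base j)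
    lift = kleisliStar base λ { {i} refl → chain i }

  star⇒steps : {St : ℕ → ℕ → Set} {a b : ℕ} → Star St a b → Σ ℕ λ k → Steps St k a b
  star⇒steps ε = 0 , refl
  star⇒steps (s ◅ path) = let (k , steps) = star⇒steps path in suc k , _ , s , steps

  transferCycle : {X : Set} (e : X → ℕ) {DomA : X → Set} {StA : X → X → Set}
    {Dom : ℕ → Set} {St : ℕ → ℕ → Set} →
    (∀ {x y} → StA x y → St (e x) (e y)) →
    (∀ {a} → Dom a → Σ X λ x → a ≡ e x × DomA x) →
    CycleOn DomA StA → SingleCycle Dom St
  transferCycle e step decode cycle a b da db with decode da | decode db
  ... | x , refl , dx | y , refl , dy = star⇒steps (gmap e step (cycle x y dx dy))

module Counting where
  open import Data.Nat using (ℕ; suc; _+_; _*_; _≤_; _<_; z≤n; s≤s; _≟_)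
  open import Data.Nat.Properties using (≤-antisym; ≤-trans; ≤-reflexive; +-suc; module ≤-Reasoning)
  open import Data.Fin using (Fin; toℕ; fromℕ<; combine; remQuot)
  open import Data.Fin.Properties using (toℕ-injective; toℕ<n; toℕ-fromℕ<; remQuot-combine; combine-remQuot)
  open import Data.List using (List; []; _∷_; _++_; length; upTo; deduplicate)
  open import Data.List.Properties using (length-++; length-upTo)
  open import Data.List.Membership.Propositional using (_∈_)
  open import Data.List.Membership.Propositional.Properties
    using (∈-∃++; ∈-++⁻; ∈-++⁺ˡ; ∈-++⁺ʳ; ∈-upTo⁺; ∈-upTo⁻; ∈-deduplicate⁺; ∈-deduplicate⁻)
  open import Data.List.Relation.Unary.Any using (here; there)
  open import Data.List.Relation.Unary.All as All using (_∷_)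
  open import Data.List.Relation.Unary.Unique.Propositional using (Unique; _∷_)
  open import Data.List.Relation.Unary.Unique.Propositional.Properties using (upTo⁺)
  open import Data.List.Relation.Unary.Unique.DecPropositional.Properties _≟_ using (deduplicate-!)
  open import Data.Product using (Σ; _×_; _,_; uncurry)
  open import Data.Sum using (inj₁; inj₂)
  open import Data.Empty using (⊥-elim)
  open import Relation.Binary.PropositionalEquality using (_≡_; refl; sym; trans; cong)

  unique-⊆-length : {A : Set} (xs ys : List A) → Unique xs → (∀ {x} → x ∈ xs → x ∈ ys) →
                    length xs ≤ length ys
  unique-⊆-length [] ys _ _ = z≤n
  unique-⊆-length (x ∷ xs) ys (x∉xs ∷ unique) xs⊆ys with ∈-∃++ (xs⊆ys (here refl))
  ... | ys₁ , ys₂ , refl = begin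
    suc (length xs)                 ≤⟨ s≤s (unique-⊆-length xs (ys₁ ++ ys₂) unique xs⊆ys₁ys₂) ⟩
    suc (length (ys₁ ++ ys₂))       ≡⟨ cong suc (length-++ ys₁) ⟩
    suc (length ys₁ + length ys₂)   ≡⟨ sym (+-suc (length ys₁) (length ys₂)) ⟩
    length ys₁ + suc (length ys₂)   ≡⟨ sym (length-++ ys₁) ⟩
    length (ys₁ ++ x ∷ ys₂)         ∎
    where
    open ≤-Reasoning
    xs⊆ys₁ys₂ : ∀ {y} → y ∈ xs → y ∈ ys₁ ++ ys₂
    xs⊆ys₁ys₂ {y} y∈xs with ∈-++⁻ ys₁ (xs⊆ys (there y∈xs))
    ... | inj₁ y∈ys₁         = ∈-++⁺ˡ y∈ys₁
    ... | inj₂ (here refl)   = ⊥-elim (All.lookup x∉xs y∈xs refl)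
    ... | inj₂ (there y∈ys₂) = ∈-++⁺ʳ ys₁ y∈ys₂

  countDistinct : ∀ N (xs : List ℕ) → (∀ {x} → x ∈ xs → x < N) → (∀ {x} → x < N → x ∈ xs) →
                  length (deduplicate _≟_ xs) ≡ N
  countDistinct N xs bounded covering = ≤-antisym
    (≤-trans (unique-⊆-length ys (upTo N) (deduplicate-! xs)
               (λ y∈ → ∈-upTo⁺ (bounded (∈-deduplicate⁻ _≟_ xs y∈))))
             (≤-reflexive (length-upTo N)))
    (≤-trans (≤-reflexive (sym (length-upTo N)))
             (unique-⊆-length (upTo N) ys (upTo⁺ N) (λ x∈ → ∈-deduplicate⁺ _≟_ (covering (∈-upTo⁻ x∈)))))
    where
    ys : List ℕ
    ys = deduplicate _≟_ xs

  record FinEncoding (L : Set) (N : ℕ) : Set where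
    field
      toFin : L → Fin N
      fromFin : Fin N → L
      from-to : ∀ l → fromFin (toFin l) ≡ l
      to-from : ∀ k → toFin (fromFin k) ≡ k

    code : L → ℕ
    code l = toℕ (toFin l)

    code-injective : ∀ {l l′} → code l ≡ code l′ → l ≡ l′
    code-injective {l} {l′} e = trans (sym (from-to l)) (trans (cong fromFin (toℕ-injective e)) (from-to l′))

    code< : ∀ l → code l < N
    code< l = toℕ<n (toFin l)

    code-surjective : ∀ {x} → x < N → Σ L λ l → code l ≡ x
    code-surjective x<N = fromFin (fromℕ< x<N) , trans (cong toℕ (to-from _)) (toℕ-fromℕ< x<N)

  productEncoding : {L : Set} {b c : ℕ} (split : L → Fin b × Fin c) (build : Fin b × Fin c → L) →
    (∀ l → build (split l) ≡ l) → (∀ p → split (build p) ≡ p) → FinEncoding L (b * c)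
  productEncoding {b = b} {c = c} split build build-split split-build = record
    { toFin = λ l → uncurry combine (split l)
    ; fromFin = λ k → build (remQuot c k)
    ; from-to = λ l → trans (cong build (remQuot-combine-pair (split l))) (build-split l)
    ; to-from = λ k → trans (cong (uncurry combine) (split-build (remQuot c k))) (combine-remQuot {b} c k) }
    where
    remQuot-combine-pair : ∀ p → remQuot c (uncurry combine p) ≡ p
    remQuot-combine-pair (i , j) = remQuot-combine i j

module Classical where
  open import Level using (Level; _⊔_)
  open import Data.Nat using (ℕ; zero; suc; _+_; _*_; _∸_; _≤_; _<_; z≤n; s≤s; _<?_; NonZero)
  open import Data.Nat.Properties
    using (m*n≡0⇒m≡0∨n≡0; m∸n+n≡m; ≮⇒≥; m<n+o⇒m∸n<o; +-identityʳ; *-monoʳ-<; *-distribˡ-+;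
           *-assoc; *-cancelˡ-≡; +-suc; *-suc; ≤-trans; ≤-reflexive; m≤n+m; +-mono-≤; module ≤-Reasoning)
  open import Data.Nat.DivMod using (_%_; _/_; m≡m%n+[m/n]*n; m%n<n)
  open import Data.Nat.Induction using (<-rec)
  open import Data.List using (List; []; _∷_; length)
  open import Data.List.Relation.Unary.All as All using (All; []; _∷_)
  open import Data.List.Relation.Unary.AllPairs using (AllPairs; []; _∷_)
  open import Data.List.Relation.Binary.Subset.Propositional using (_⊆_)
  open import Data.List.Relation.Binary.Subset.Propositional.Properties
    using (⊆-trans; xs⊆x∷xs; ∷⁺ʳ; All-resp-⊇)
  open import Data.Product using (Σ; _×_; _,_)
  open import Data.Sum using (inj₂)
  open import Data.Empty using (⊥; ⊥-elim)
  open import Relation.Nullary using (¬_; Dec; yes; no)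
  open import Relation.Nullary.Decidable using (¬¬-excluded-middle)
  open import Relation.Binary.PropositionalEquality using (_≡_; refl; sym; trans; cong; subst)

  private
    variable
      a b ℓ : Level
      A : Set a
      B : Set b

  -- The
  -- counting argument below is classical; its conclusion (an inequality
  -- of naturals) is decidable, so double negations are removed at the end.
  return¬¬ : A → ¬ ¬ A
  return¬¬ x k = k x

  infixl 1 _>>=¬¬_
  _>>=¬¬_ : ¬ ¬ A → (A → ¬ ¬ B) → ¬ ¬ B
  (x >>=¬¬ f) k = x (λ y → f y k)

  IsLeastPositive : (ℕ → Set ℓ) → ℕ → Set ℓ
  IsLeastPositive I d = 0 < d × I d × (∀ e → e < d → I e → e ≡ 0)

  leastPositive : (I : ℕ → Set ℓ) → ∀ N → I N → 0 < N → ¬ ¬ Σ ℕ (IsLeastPositive I)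
  leastPositive I = <-rec _ search
    where
    search : ∀ N → (∀ {M} → M < N → I M → 0 < M → ¬ ¬ Σ ℕ (IsLeastPositive I)) →
             I N → 0 < N → ¬ ¬ Σ ℕ (IsLeastPositive I)
    search N smaller iN 0<N =
      ¬¬-excluded-middle {A = Σ ℕ λ e → e < N × 0 < e × I e} >>=¬¬ λ where
      (yes (e , e<N , 0<e , ie)) → smaller e<N ie 0<e
      (no noneBelow) → return¬¬ (N , 0<N , iN , λ where
        zero    _   _  → refl
        (suc e) e<N ie → ⊥-elim (noneBelow (suc e , e<N , s≤s z≤n , ie)))

  -- A set of naturals containing 0 and closed under sums and differences;
  -- e.g. { c | c • g ∈ Z } for an element g and a subgroup Z of a group.
  record DifferenceClosed (I : ℕ → Set ℓ) : Set ℓ where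
    field
      zero∈ : I 0
      +-closed : ∀ {x y} → I x → I y → I (x + y)
      ∸-closed : ∀ {x y} → I (x + y) → I y → I x

  SameResidue : (ℕ → Set ℓ) → ℕ → ℕ → Set ℓ
  SameResidue I x y = Σ ℕ λ r → Σ ℕ λ q → Σ ℕ λ q′ →
    I q × I q′ × x ≡ r + q × y ≡ r + q′

  module _ {I : ℕ → Set ℓ} (closed : DifferenceClosed I) where
    open DifferenceClosed closed

    module ModuloLeast (d : ℕ) .{{_ : NonZero d}} (d∈ : I d) (least : ∀ e → e < d → I e → e ≡ 0) where

      multiple : ∀ q → I (q * d)
      multiple zero    = zero∈
      multiple (suc q) = +-closed d∈ (multiple q)

      double-decomposition : ∀ x → 2 * x ≡ 2 * (x % d) + 2 * (x / d) * d
      double-decomposition x = trans (cong (2 *_) (m≡m%n+[m/n]*n x d))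
        (trans (*-distribˡ-+ 2 (x % d) (x / d * d))
               (cong (2 * (x % d) +_) (sym (*-assoc 2 (x / d) d))))

      doubleResidue : ∀ x → I (2 * x) → ¬ I x → 2 * (x % d) ≡ d
      doubleResidue x 2x∈ x∉ = compare (2 * (x % d) <? d)
        where
        2r∈ : I (2 * (x % d))
        2r∈ = ∸-closed (subst I (double-decomposition x) 2x∈) (multiple (2 * (x / d)))
        compare : Dec (2 * (x % d) < d) → 2 * (x % d) ≡ d
        compare (yes 2r<d) with m*n≡0⇒m≡0∨n≡0 2 (least _ 2r<d 2r∈)
        ... | inj₂ r≡0 = ⊥-elim (x∉ (subst I (sym x≡) (multiple (x / d))))
          where
          x≡ : x ≡ x / d * d
          x≡ = trans (m≡m%n+[m/n]*n x d) (cong (_+ x / d * d) r≡0)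
        compare (no 2r≮d) = trans (sym (m∸n+n≡m d≤2r)) (cong (_+ d) (least _ below 2r-d∈))
          where
          d≤2r : d ≤ 2 * (x % d)
          d≤2r = ≮⇒≥ 2r≮d
          below : 2 * (x % d) ∸ d < d
          below = m<n+o⇒m∸n<o (2 * (x % d)) d
            (subst (2 * (x % d) <_) (cong (d +_) (+-identityʳ d)) (*-monoʳ-< 2 (m%n<n x d)))
          2r-d∈ : I (2 * (x % d) ∸ d)
          2r-d∈ = ∸-closed (subst I (sym (m∸n+n≡m d≤2r)) 2r∈) d∈

      -- hence all such x share the residue d/2
      sameResidue : ∀ {a b} → I (2 * a) → ¬ I a → I (2 * b) → ¬ I b → SameResidue I a b
      sameResidue {a} {b} 2a∈ a∉ 2b∈ b∉ =
        a % d , a / d * d , b / d * d , multiple (a / d) , multiple (b / d) ,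
        m≡m%n+[m/n]*n a d , trans (m≡m%n+[m/n]*n b d) (cong (_+ b / d * d) (sym residues≡))
        where
        residues≡ : a % d ≡ b % d
        residues≡ = *-cancelˡ-≡ (a % d) (b % d) 2
          (trans (doubleResidue a 2a∈ a∉) (sym (doubleResidue b 2b∈ b∉)))

    -- The quotient ℕ/I is cyclic, so it has at most one residue class of
    -- order two: any a, b with 2a, 2b ∈ I but a, b ∉ I are congruent.
    uniqueHalf : ∀ {N} → I N → 0 < N → ∀ {a b} → I (2 * a) → ¬ I a → I (2 * b) → ¬ I b →
                 ¬ ¬ SameResidue I a b
    uniqueHalf N∈ 0<N 2a∈ a∉ 2b∈ b∉ = leastPositive I _ N∈ 0<N >>=¬¬ λ where
      (zero , () , _)
      (suc d , _ , d∈ , least) → return¬¬ (ModuloLeast.sameResidue (suc d) d∈ least 2a∈ a∉ 2b∈ b∉)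

  module GreedyRepresentatives {A : Set a} {Q : A → Set ℓ} {R E : A → A → Set ℓ}
    (noTriple : ∀ {t u v} → Q t → Q u → Q v → R t u → R t v → R u v → E t u → E t v → ⊥)
    where

    record Split (t : A) (xs : List A) : Set (a ⊔ ℓ) where
      field
        near far : List A
        near⊆ : near ⊆ xs
        far⊆ : far ⊆ xs
        allNear : All (E t) near
        allFar : All (λ u → ¬ E t u) far
        nearApart : AllPairs R near
        farApart : AllPairs R far
        length≡ : length xs ≡ length near + length far

    split : ∀ t xs → AllPairs R xs → ¬ ¬ Split t xs
    split t [] [] = return¬¬ record
      { near = [] ; far = [] ; near⊆ = λ () ; far⊆ = λ () ; allNear = [] ; allFar = []
      ; nearApart = [] ; farApart = [] ; length≡ = refl }
    split t (x ∷ xs) (x-apart ∷ apart) = split t xs apart >>=¬¬ λ s →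
      ¬¬-excluded-middle {A = E t x} >>=¬¬ λ where
        (yes near-x) → return¬¬ record
          { near = x ∷ near s ; far = far s ; near⊆ = ∷⁺ʳ x (near⊆ s) ; far⊆ = extend (far⊆ s)
          ; allNear = near-x ∷ allNear s ; allFar = allFar s
          ; nearApart = All-resp-⊇ (near⊆ s) x-apart ∷ nearApart s ; farApart = farApart s
          ; length≡ = cong suc (length≡ s) }
        (no far-x) → return¬¬ record
          { near = near s ; far = x ∷ far s ; near⊆ = extend (near⊆ s) ; far⊆ = ∷⁺ʳ x (far⊆ s)
          ; allNear = allNear s ; allFar = far-x ∷ allFar s
          ; nearApart = nearApart s ; farApart = All-resp-⊇ (far⊆ s) x-apart ∷ farApart s
          ; length≡ = trans (cong suc (length≡ s)) (sym (+-suc (length (near s)) (length (far s)))) }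
      where
      open Split
      extend : ∀ {ys} → ys ⊆ xs → ys ⊆ x ∷ xs
      extend ys⊆ = ⊆-trans ys⊆ (xs⊆x∷xs xs x)

    record Representatives (ts : List A) : Set (a ⊔ ℓ) where
      field
        reps : List A
        reps⊆ : reps ⊆ ts
        repsApart : AllPairs (λ u v → ¬ E u v) reps
        atLeastHalf : length ts ≤ 2 * length reps

    nearAtMostOne : ∀ {t ys} → Q t → All Q ys → All (R t) ys → All (E t) ys → AllPairs R ys →
                    length ys ≤ 1
    nearAtMostOne qt [] _ _ _ = z≤n
    nearAtMostOne qt (_ ∷ []) _ _ _ = s≤s z≤n
    nearAtMostOne qt (qu ∷ qv ∷ _) (rtu ∷ rtv ∷ _) (etu ∷ etv ∷ _) ((ruv ∷ _) ∷ _) =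
      ⊥-elim (noTriple qt qu qv rtu rtv ruv etu etv)

    representatives : ∀ n ts → length ts ≤ n → All Q ts → AllPairs R ts → ¬ ¬ Representatives ts
    representatives n [] _ _ _ = return¬¬ record { reps = [] ; reps⊆ = λ () ; repsApart = [] ; atLeastHalf = z≤n }
    representatives (suc n) (t ∷ rest) (s≤s |ts|≤) (qt ∷ qs) (t-apart ∷ apart) =
      split t rest apart >>=¬¬ λ s →
      representatives n (far s) (far-short s) (All-resp-⊇ (far⊆ s) qs) (farApart s) >>=¬¬ λ r →
      return¬¬ record
        { reps = t ∷ reps r
        ; reps⊆ = ∷⁺ʳ t (⊆-trans (reps⊆ r) (far⊆ s))
        ; repsApart = All-resp-⊇ (reps⊆ r) (allFar s) ∷ repsApart r
        ; atLeastHalf = count (length≡ s) (nearOne s) (atLeastHalf r) }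
      where
      open Split
      open Representatives
      far-short : ∀ s → length (far s) ≤ n
      far-short s = ≤-trans (m≤n+m _ _) (≤-trans (≤-reflexive (sym (length≡ s))) |ts|≤)
      nearOne : ∀ s → length (near s) ≤ 1
      nearOne s = nearAtMostOne qt (All-resp-⊇ (near⊆ s) qs) (All-resp-⊇ (near⊆ s) t-apart)
                    (allNear s) (nearApart s)
      count : ∀ {r y z p} → r ≡ y + z → y ≤ 1 → z ≤ 2 * p → suc r ≤ 2 * suc p
      count {y = y} {z} {p} refl y≤1 z≤2p = begin
        suc (y + z)     ≤⟨ s≤s (+-mono-≤ y≤1 z≤2p) ⟩
        suc (1 + 2 * p) ≡⟨ sym (*-suc 2 p) ⟩
        2 * suc p       ∎
        where open ≤-Reasoning

module TwoTorsion where
  open import Level using (_⊔_)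
  open Classical
  open import Algebra.Bundles using (AbelianGroup)
  open import Data.Nat using (ℕ; zero; suc; _+_; _*_; _^_; _≤_; _≤?_; z≤n; s≤s)
  open import Data.Nat.Properties using (*-suc; ≤-refl; ≤-trans; *-monoʳ-≤)
  open import Data.Integer using (ℤ; +_; -[1+_])
  open import Data.Vec using (Vec; []; _∷_; lookup)
  open import Data.Fin using (zero; suc)
  open import Data.List using (List; []; _∷_; length)
  open import Data.List.Relation.Unary.All as All using (All; []; _∷_)
  open import Data.List.Relation.Unary.AllPairs as AllPairs using (AllPairs; []; _∷_)
  open import Data.List.Relation.Binary.Subset.Propositional.Properties using (All-resp-⊇)
  open import Data.Product using (Σ; _×_; _,_)
  open import Data.Empty using (⊥; ⊥-elim)
  open import Relation.Nullary using (¬_)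
  open import Relation.Nullary.Decidable using (decidable-stable)
  open import Relation.Binary.PropositionalEquality as ≡ using (_≡_)

  module _ {c ℓ} (G : AbelianGroup c ℓ) where
    open AbelianGroup G renaming (refl to ≈-refl; sym to ≈-sym; trans to ≈-trans)
    open import Algebra.Properties.AbelianGroup G
    open import Algebra.Properties.CommutativeSemigroup commutativeSemigroup using (interchange)
    open import Algebra.Properties.CommutativeMonoid.Mult commutativeMonoid
      using (×-congʳ; ×-homo-+; ×-assocˡ; ×-distrib-+) renaming (_×_ to _·_)
    open import Relation.Binary.Reasoning.Setoid setoid

    natMul≈· : ∀ n x → natMul G n x ≈ n · x
    natMul≈· zero    x = ≈-refl
    natMul≈· (suc n) x = ∙-congˡ (natMul≈· n x)

    ·-ε : ∀ n → n · ε ≈ ε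
    ·-ε zero    = ≈-refl
    ·-ε (suc n) = ≈-trans (identityˡ _) (·-ε n)

    ·-⁻¹ : ∀ n x → n · (x ⁻¹) ≈ (n · x) ⁻¹
    ·-⁻¹ zero    x = ≈-sym ε⁻¹≈ε
    ·-⁻¹ (suc n) x = ≈-trans (∙-congˡ (·-⁻¹ n x)) (⁻¹-∙-comm _ _)

    cancelʳ : ∀ x w → (x ∙ w) ∙ w ⁻¹ ≈ x
    cancelʳ x w = ≈-trans (∙-congʳ (comm x w)) (xyx⁻¹≈y w x)

    difference-cancelʳ : ∀ x y w → (x ∙ w) ∙ (y ∙ w) ⁻¹ ≈ x ∙ y ⁻¹
    difference-cancelʳ x y w = begin
      (x ∙ w) ∙ (y ∙ w) ⁻¹     ≈⟨ ∙-congˡ (≈-sym (⁻¹-∙-comm y w)) ⟩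
      (x ∙ w) ∙ (y ⁻¹ ∙ w ⁻¹)  ≈⟨ interchange x w (y ⁻¹) (w ⁻¹) ⟩
      (x ∙ y ⁻¹) ∙ (w ∙ w ⁻¹)  ≈⟨ ∙-congˡ (inverseʳ w) ⟩
      (x ∙ y ⁻¹) ∙ ε           ≈⟨ identityʳ _ ⟩
      x ∙ y ⁻¹                 ∎

    order≤2 : ∀ {t x} → t ≈ x → t ≈ x ⁻¹ → 2 · t ≈ ε
    order≤2 {t} {x} t≈x t≈x⁻¹ = begin
      t ∙ (t ∙ ε)  ≈⟨ ∙-cong t≈x (≈-trans (identityʳ t) t≈x⁻¹) ⟩
      x ∙ x ⁻¹     ≈⟨ inverseʳ x ⟩
      ε            ∎

    record Subgroup (Z : Carrier → Set ℓ) : Set (c ⊔ ℓ) where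
      field
        ε∈ : Z ε
        ∙-closed : ∀ {x y} → Z x → Z y → Z (x ∙ y)
        ⁻¹-closed : ∀ {x} → Z x → Z (x ⁻¹)
        ≈-resp : ∀ {x y} → x ≈ y → Z x → Z y

    module Congruence {Z : Carrier → Set ℓ} (subgroup : Subgroup Z) where
      open Subgroup subgroup

      infix 4 _~_
      _~_ : Carrier → Carrier → Set ℓ
      x ~ y = Z (x ∙ y ⁻¹)

      ≈⇒~ : ∀ {x y} → x ≈ y → x ~ y
      ≈⇒~ x≈y = ≈-resp (≈-sym (x≈y⇒x∙y⁻¹≈ε x≈y)) ε∈

      ~-sym : ∀ {x y} → x ~ y → y ~ x
      ~-sym {x} {y} x~y = ≈-resp (begin
        (x ∙ y ⁻¹) ⁻¹    ≈⟨ ⁻¹-anti-homo-∙ x (y ⁻¹) ⟩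
        y ⁻¹ ⁻¹ ∙ x ⁻¹   ≈⟨ ∙-congʳ (⁻¹-involutive y) ⟩
        y ∙ x ⁻¹         ∎) (⁻¹-closed x~y)

      ~-trans : ∀ {x y w} → x ~ y → y ~ w → x ~ w
      ~-trans {x} {y} {w} x~y y~w = ≈-resp (begin
        (x ∙ y ⁻¹) ∙ (y ∙ w ⁻¹)  ≈⟨ assoc x (y ⁻¹) (y ∙ w ⁻¹) ⟩
        x ∙ (y ⁻¹ ∙ (y ∙ w ⁻¹))  ≈⟨ ∙-congˡ (≈-sym (assoc (y ⁻¹) y (w ⁻¹))) ⟩
        x ∙ ((y ⁻¹ ∙ y) ∙ w ⁻¹)  ≈⟨ ∙-congˡ (∙-congʳ (inverseˡ y)) ⟩
        x ∙ (ε ∙ w ⁻¹)           ≈⟨ ∙-congˡ (identityˡ (w ⁻¹)) ⟩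
        x ∙ w ⁻¹                 ∎) (∙-closed x~y y~w)

      ~-∙ : ∀ {x x′ y y′} → x ~ x′ → y ~ y′ → x ∙ y ~ x′ ∙ y′
      ~-∙ {x} {x′} {y} {y′} p q = ≈-resp (begin
        (x ∙ x′ ⁻¹) ∙ (y ∙ y′ ⁻¹)  ≈⟨ interchange x (x′ ⁻¹) y (y′ ⁻¹) ⟩
        (x ∙ y) ∙ (x′ ⁻¹ ∙ y′ ⁻¹)  ≈⟨ ∙-congˡ (⁻¹-∙-comm x′ y′) ⟩
        (x ∙ y) ∙ (x′ ∙ y′) ⁻¹     ∎) (∙-closed p q)

      ~-⁻¹ : ∀ {x y} → x ~ y → x ⁻¹ ~ y ⁻¹
      ~-⁻¹ p = ≈-resp (≈-sym (⁻¹-∙-comm _ _)) (⁻¹-closed p)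

      ~-· : ∀ n {x y} → x ~ y → n · x ~ n · y
      ~-· zero    p = ≈⇒~ ≈-refl
      ~-· (suc n) p = ~-∙ p (~-· n p)

      ∈⇒~ε : ∀ {x} → Z x → x ~ ε
      ∈⇒~ε {x} z = ≈-resp (≈-sym (≈-trans (∙-congˡ ε⁻¹≈ε) (identityʳ x))) z

      ~ε⇒∈ : ∀ {x} → x ~ ε → Z x
      ~ε⇒∈ {x} z = ≈-resp (≈-trans (∙-congˡ ε⁻¹≈ε) (identityʳ x)) z

      ~-cancelˡ : ∀ t {x y} → t ∙ x ~ t ∙ y → x ~ y
      ~-cancelˡ t {x} {y} p =
        ≈-resp (≈-trans (∙-cong (comm t x) (⁻¹-cong (comm t y))) (difference-cancelʳ x y t)) p

      ~-resp-≈ : ∀ {x y x′ y′} → x ≈ x′ → y ≈ y′ → x ~ y → x′ ~ y′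
      ~-resp-≈ e f p = ~-trans (≈⇒~ (≈-sym e)) (~-trans p (≈⇒~ f))

    Admissible : (Z : Carrier → Set ℓ) → ∀ {k} → Vec Carrier k → Carrier → Set ℓ
    Admissible Z {k} gs t = Z (2 · t) × Σ (Vec ℤ k) λ as → Z (t ∙ (linComb G as gs) ⁻¹)

    module AdjoinTorsion {Z : Carrier → Set ℓ} (subgroup : Subgroup Z)
                         (g : Carrier) (n : ℕ) (order : suc n · g ≈ ε) where
      open Subgroup subgroup
      open Congruence subgroup

      negate : ∀ b → (b * n) · g ≈ (b · g) ⁻¹
      negate b = inverseʳ-unique (b · g) ((b * n) · g) (begin
        b · g ∙ (b * n) · g  ≈⟨ ≈-sym (×-homo-+ g b (b * n)) ⟩
        (b + b * n) · g      ≡⟨ ≡.cong (_· g) (≡.sym (*-suc b n)) ⟩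
        (b * suc n) · g      ≈⟨ ≈-sym (×-assocˡ g b (suc n)) ⟩
        b · (suc n · g)      ≈⟨ ×-congʳ b order ⟩
        b · ε                ≈⟨ ·-ε b ⟩
        ε                    ∎)

      natCoefficient : ℤ → ℕ
      natCoefficient (+ k)    = k
      natCoefficient -[1+ k ] = suc k * n

      intMul≈ : ∀ a → intMul G a g ≈ natCoefficient a · g
      intMul≈ (+ k)    = natMul≈· k g
      intMul≈ -[1+ k ] = ≈-trans (⁻¹-cong (natMul≈· (suc k) g)) (≈-sym (negate (suc k)))

      Z⁺ : Carrier → Set ℓ
      Z⁺ x = Σ ℕ λ b → x ~ b · g

      Z⁺-subgroup : Subgroup Z⁺
      Z⁺-subgroup = record
        { ε∈ = 0 , ≈⇒~ ≈-refl
        ; ∙-closed = λ { (b , p) (b′ , q) → b + b′ , ~-trans (~-∙ p q) (≈⇒~ (≈-sym (×-homo-+ g b b′))) }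
        ; ⁻¹-closed = λ { (b , p) → b * n , ~-trans (~-⁻¹ p) (≈⇒~ (≈-sym (negate b))) }
        ; ≈-resp = λ { e (b , p) → b , ~-resp-≈ e ≈-refl p } }

      admissible⁺ : ∀ {k} (gs : Vec Carrier k) {t} → Admissible Z (g ∷ gs) t → Admissible Z⁺ gs t
      admissible⁺ gs {t} (2t∈ , a ∷ as , t~) = (0 , ∈⇒~ε 2t∈) , as , natCoefficient a ,
        ~-trans (~-∙ t~ (≈⇒~ ≈-refl)) (≈⇒~ (≈-trans (cancelʳ _ _) (intMul≈ a)))

      -- Each class modulo Z⁺ meets at most two classes modulo Z of admissible
      -- elements: the multiples c with c · g ∈ Z form a difference-closed set,
      -- and ⟨g⟩ / (⟨g⟩ ∩ Z) is cyclic, with at most one element of order two.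
      noTriple : ∀ {k} (gs : Vec Carrier k) {t u v} →
        Admissible Z (g ∷ gs) t → Admissible Z (g ∷ gs) u → Admissible Z (g ∷ gs) v →
        ¬ t ~ u → ¬ t ~ v → ¬ u ~ v → Z⁺ (t ∙ u ⁻¹) → Z⁺ (t ∙ v ⁻¹) → ⊥
      noTriple gs {t} {u} {v} (2t∈ , _) (2u∈ , _) (2v∈ , _) t≁u t≁v u≁v (a , t-u~a) (b , t-v~b) =
        uniqueHalf multiplesInZ {N = suc n} (≈-resp (≈-sym order) ε∈) (s≤s z≤n) {a} {b}
          (double {c = a} t-u~a 2u∈) (notIn {c = a} t-u~a t≁u)
          (double {c = b} t-v~b 2v∈) (notIn {c = b} t-v~b t≁v)
          λ { (r , q , q′ , q∈ , q′∈ , a≡ , b≡) → u≁v (sameClass r q∈ q′∈ a≡ b≡) }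
        where
        I : ℕ → Set ℓ
        I c = Z (c · g)

        multiplesInZ : DifferenceClosed I
        multiplesInZ = record
          { zero∈ = ε∈
          ; +-closed = λ {x} {y} ix iy → ≈-resp (≈-sym (×-homo-+ g x y)) (∙-closed ix iy)
          ; ∸-closed = λ {x} {y} ixy iy →
              ≈-resp (≈-trans (∙-congʳ (×-homo-+ g x y)) (cancelʳ _ _)) (∙-closed ixy (⁻¹-closed iy)) }

        double : ∀ {w c} → t ∙ w ⁻¹ ~ c · g → Z (2 · w) → I (2 * c)
        double {w} {c} t-w~ 2w∈ = ~ε⇒∈ (~-trans (≈⇒~ (≈-sym (×-assocˡ g 2 c)))
          (~-trans (~-· 2 (~-sym t-w~)) (∈⇒~ε (≈-resp twice (∙-closed 2t∈ (⁻¹-closed 2w∈))))))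
          where
          twice : 2 · t ∙ (2 · w) ⁻¹ ≈ 2 · (t ∙ w ⁻¹)
          twice = ≈-sym (≈-trans (×-distrib-+ t (w ⁻¹) 2) (∙-congˡ (·-⁻¹ 2 w)))

        notIn : ∀ {w c} → t ∙ w ⁻¹ ~ c · g → ¬ t ~ w → ¬ I c
        notIn t-w~ t≁w c∈ = t≁w (~ε⇒∈ (~-trans t-w~ (∈⇒~ε c∈)))

        sameClass : ∀ r {q q′} → I q → I q′ → a ≡ r + q → b ≡ r + q′ → u ~ v
        sameClass r {q} {q′} q∈ q′∈ a≡ b≡ = ~-resp-≈ (⁻¹-involutive u) (⁻¹-involutive v) (~-⁻¹ u⁻¹~v⁻¹)
          where
          dropMultiple : ∀ {p} → I p → (r + p) · g ~ r · g
          dropMultiple {p} p∈ = ~-resp-≈ (≈-sym (×-homo-+ g r p)) (identityʳ _) (~-∙ (≈⇒~ ≈-refl) (∈⇒~ε p∈))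
          u⁻¹~v⁻¹ : u ⁻¹ ~ v ⁻¹
          u⁻¹~v⁻¹ = ~-cancelˡ t (~-trans (≡.subst (λ c → t ∙ u ⁻¹ ~ c · g) a≡ t-u~a)
            (~-trans (dropMultiple q∈) (~-sym (~-trans (≡.subst (λ c → t ∙ v ⁻¹ ~ c · g) b≡ t-v~b)
              (dropMultiple q′∈)))))

    -- Induction on k: modulo
    -- Z + ⟨g⟩ the elements collapse at most two to one.
    countAdmissible : ∀ k {Z} → Subgroup Z → (gs : Vec Carrier k) →
      (∀ i → IsTorsion G (lookup gs i)) → (ts : List Carrier) →
      All (Admissible Z gs) ts → AllPairs (λ t u → ¬ Z (t ∙ u ⁻¹)) ts → ¬ ¬ (length ts ≤ 2 ^ k)
    countAdmissible zero sub [] _ [] _ _ = return¬¬ z≤n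
    countAdmissible zero sub [] _ (_ ∷ []) _ _ = return¬¬ (s≤s z≤n)
    countAdmissible zero sub [] _ (_ ∷ _ ∷ _) ((_ , [] , t~ε) ∷ (_ , [] , u~ε) ∷ _) ((t≁u ∷ _) ∷ _) =
      ⊥-elim (t≁u (~-trans t~ε (~-sym u~ε)))
      where open Congruence sub
    countAdmissible (suc k) sub (g ∷ gs) torsion ts admissible apart with torsion zero
    ... | n , order =
      representatives (length ts) ts ≤-refl admissible apart >>=¬¬ λ r →
      countAdmissible k Z⁺-subgroup gs (λ i → torsion (suc i)) (reps r)
        (All.map (admissible⁺ gs) (All-resp-⊇ (reps⊆ r) admissible)) (repsApart r) >>=¬¬ λ ≤2^k →
      return¬¬ (≤-trans (atLeastHalf r) (*-monoʳ-≤ 2 ≤2^k))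
      where
      open AdjoinTorsion sub g n (≈-trans (≈-sym (natMul≈· (suc n) g)) order)
      open GreedyRepresentatives (noTriple gs)
      open Representatives

    twoTorsionBound : ∀ k (gs : Vec Carrier k) → GeneratesTorsion G gs → (ts : List Carrier) →
      All (λ t → 2 · t ≈ ε) ts → AllPairs (λ t u → ¬ t ≈ u) ts → length ts ≤ 2 ^ k
    twoTorsionBound k gs (torsion , generates) ts ts-order≤2 distinct =
      decidable-stable (length ts ≤? 2 ^ k)
        (countAdmissible k trivial gs torsion ts (All.map admissible ts-order≤2) (AllPairs.map apart distinct))
      where
      trivial : Subgroup (_≈ ε)
      trivial = record
        { ε∈ = ≈-refl
        ; ∙-closed = λ x≈ε y≈ε → ≈-trans (∙-cong x≈ε y≈ε) (identityˡ ε)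
        ; ⁻¹-closed = λ x≈ε → ≈-trans (⁻¹-cong x≈ε) ε⁻¹≈ε
        ; ≈-resp = λ x≈y x≈ε → ≈-trans (≈-sym x≈y) x≈ε }
      admissible : ∀ {t} → 2 · t ≈ ε → Admissible (_≈ ε) gs t
      admissible {t} 2t≈ε with generates t (1 , ≈-trans (natMul≈· 2 t) 2t≈ε)
      ... | as , span≈t = 2t≈ε , as , x≈y⇒x∙y⁻¹≈ε (≈-sym span≈t)
      apart : ∀ {t u} → ¬ t ≈ u → ¬ (t ∙ u ⁻¹ ≈ ε)
      apart t≉u t-u≈ε = t≉u (x∙y⁻¹≈ε⇒x≈y _ _ t-u≈ε)

module Construction (n : ℕ) where
  open CyclicOrder
  open Counting
  open Cycles
  open TwoTorsion
  open import Algebra.Bundles using (AbelianGroup)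
  open import Data.Nat using (ℕ; zero; suc; _+_; _*_; _^_; _≤_; _<_; _≟_)
  open import Data.Nat.Properties using (*-comm)
  open import Data.Fin using (Fin; zero; suc; combine; remQuot)
  open import Data.Fin.Induction using (<-weakInduction)
  open import Data.Fin.Properties using (remQuot-combine; combine-remQuot) renaming (_≟_ to _≟ᶠ_)
  open import Data.List using (List; tabulate; length; map; deduplicate)
  open import Data.List.Properties using (length-tabulate)
  open import Data.List.Membership.Propositional using (_∈_)
  open import Data.List.Membership.Propositional.Properties
    using (∈-tabulate⁺; ∈-tabulate⁻; ∈-map⁺; ∈-map⁻; ∈-deduplicate⁺; ∈-deduplicate⁻; ∈-++⁻; ∈-++⁺ˡ; ∈-++⁺ʳ)
  open import Data.List.Relation.Unary.Unique.Propositional using (Unique)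
  import Data.List.Relation.Unary.All.Properties as All
  import Data.List.Relation.Unary.AllPairs.Properties as AllPairs
  import Data.List.Relation.Unary.Unique.Propositional.Properties as Unique
  open import Data.Product using (Σ; _×_; _,_; proj₁; proj₂; uncurry)
  open import Data.Sum using (_⊎_; inj₁; inj₂)
  open import Data.Empty using (⊥-elim)
  open import Relation.Nullary using (¬_; Dec; yes; no)
  open import Relation.Binary.PropositionalEquality
    using (_≡_; refl; sym; trans; cong; cong₂; subst; module ≡-Reasoning)
  open import Relation.Binary.Construct.Closure.ReflexiveTransitive using (Star; ε; _◅_)
  open import Data.Nat.Tactic.RingSolver using (solve-∀)

  m : ℕ
  m = suc (suc n)

  Index : Set
  Index = Fin m

  data Row : Set where
    P Q : Row
    A A' : Index → Row

  data Col : Set where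
    C D D' : Index → Col

  data Sym : Set where
    S E E' : Index → Sym

  Cell : Set
  Cell = Row × Col × Sym

  -- Rows P and Q and the
  -- columns C j link block j to the next block; the white cells
  -- (A j, C j, S j), (P, C j, E j), (A j, D j, E j), (P, D j, S j) force
  -- f(A j) - f(P) = k(S j) - k(E j) = k(E j) - k(S j) in any embedding.
  white : Index → Fin 8 → Cell
  white j zero                                      = P , C j , E j
  white j (suc zero)                                = P , D j , S j
  white j (suc (suc zero))                          = A j , C j , S j
  white j (suc (suc (suc zero)))                    = A j , D j , E j
  white j (suc (suc (suc (suc zero))))              = Q , C (next j) , E' j
  white j (suc (suc (suc (suc (suc zero)))))        = Q , D' j , S j
  white j (suc (suc (suc (suc (suc (suc zero))))))  = A' j , C (next j) , S j
  white j (suc (suc (suc (suc (suc (suc (suc zero))))))) = A' j , D' j , E' j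

  black : Index → Fin 8 → Cell
  black j zero                                      = P , C (next j) , S j
  black j (suc zero)                                = Q , C j , S j
  black j (suc (suc zero))                          = P , D j , E j
  black j (suc (suc (suc zero)))                    = A j , C j , E j
  black j (suc (suc (suc (suc zero))))              = A j , D j , S j
  black j (suc (suc (suc (suc (suc zero)))))        = Q , D' j , E' j
  black j (suc (suc (suc (suc (suc (suc zero))))))  = A' j , C (next j) , E' j
  black j (suc (suc (suc (suc (suc (suc (suc zero))))))) = A' j , D' j , S j

  c₀ c₁ c₂ c₃ c₄ c₅ c₆ c₇ : Fin 8
  c₀ = zero
  c₁ = suc zero
  c₂ = suc (suc zero)
  c₃ = suc (suc (suc zero))
  c₄ = suc (suc (suc (suc zero)))
  c₅ = suc (suc (suc (suc (suc zero))))
  c₆ = suc (suc (suc (suc (suc (suc zero)))))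
  c₇ = suc (suc (suc (suc (suc (suc (suc zero))))))

  IsCell : (Index → Fin 8 → Cell) → Cell → Set
  IsCell colour t = Σ Index λ j → Σ (Fin 8) λ i → colour j i ≡ t

  positionOfWhite : Cell → Index × Fin 8
  positionOfWhite (P , C _ , E j)   = j , c₀
  positionOfWhite (P , D j , _)     = j , c₁
  positionOfWhite (A j , C _ , _)   = j , c₂
  positionOfWhite (A j , D _ , _)   = j , c₃
  positionOfWhite (Q , C _ , E' j)  = j , c₄
  positionOfWhite (Q , D' j , _)    = j , c₅
  positionOfWhite (A' j , C _ , _)  = j , c₆
  positionOfWhite (A' j , D' _ , _) = j , c₇
  positionOfWhite _                 = zero , zero

  positionOfBlack : Cell → Index × Fin 8
  positionOfBlack (P , C _ , S j)   = j , c₀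
  positionOfBlack (Q , C _ , S j)   = j , c₁
  positionOfBlack (P , D j , _)     = j , c₂
  positionOfBlack (A j , C _ , _)   = j , c₃
  positionOfBlack (A j , D _ , _)   = j , c₄
  positionOfBlack (Q , D' j , _)    = j , c₅
  positionOfBlack (A' j , C _ , _)  = j , c₆
  positionOfBlack (A' j , D' _ , _) = j , c₇
  positionOfBlack _                 = zero , zero

  positionOfWhite-white : ∀ j i → positionOfWhite (white j i) ≡ (j , i)
  positionOfWhite-white j zero                                      = refl
  positionOfWhite-white j (suc zero)                                = refl
  positionOfWhite-white j (suc (suc zero))                          = refl
  positionOfWhite-white j (suc (suc (suc zero)))                    = refl
  positionOfWhite-white j (suc (suc (suc (suc zero))))              = refl
  positionOfWhite-white j (suc (suc (suc (suc (suc zero)))))        = refl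
  positionOfWhite-white j (suc (suc (suc (suc (suc (suc zero))))))  = refl
  positionOfWhite-white j (suc (suc (suc (suc (suc (suc (suc zero))))))) = refl

  positionOfBlack-black : ∀ j i → positionOfBlack (black j i) ≡ (j , i)
  positionOfBlack-black j zero                                      = refl
  positionOfBlack-black j (suc zero)                                = refl
  positionOfBlack-black j (suc (suc zero))                          = refl
  positionOfBlack-black j (suc (suc (suc zero)))                    = refl
  positionOfBlack-black j (suc (suc (suc (suc zero))))              = refl
  positionOfBlack-black j (suc (suc (suc (suc (suc zero)))))        = refl
  positionOfBlack-black j (suc (suc (suc (suc (suc (suc zero))))))  = refl
  positionOfBlack-black j (suc (suc (suc (suc (suc (suc (suc zero))))))) = refl

  rowEncoding : FinEncoding Row (2 * suc m)
  rowEncoding = productEncoding split build build-split split-build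
    where
    split : Row → Fin 2 × Fin (suc m)
    split P      = zero , zero
    split (A j)  = zero , suc j
    split Q      = suc zero , zero
    split (A' j) = suc zero , suc j
    build : Fin 2 × Fin (suc m) → Row
    build (zero , zero)         = P
    build (zero , suc j)        = A j
    build (suc zero , zero)     = Q
    build (suc zero , suc j)    = A' j
    build-split : ∀ r → build (split r) ≡ r
    build-split P      = refl
    build-split (A j)  = refl
    build-split Q      = refl
    build-split (A' j) = refl
    split-build : ∀ p → split (build p) ≡ p
    split-build (zero , zero)      = refl
    split-build (zero , suc j)     = refl
    split-build (suc zero , zero)  = refl
    split-build (suc zero , suc j) = refl

  colEncoding : FinEncoding Col (3 * m)
  colEncoding = productEncoding split build build-split split-build
    where
    split : Col → Fin 3 × Index
    split (C j)  = zero , j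
    split (D j)  = suc zero , j
    split (D' j) = suc (suc zero) , j
    build : Fin 3 × Index → Col
    build (zero , j)           = C j
    build (suc zero , j)       = D j
    build (suc (suc zero) , j) = D' j
    build-split : ∀ c → build (split c) ≡ c
    build-split (C j)  = refl
    build-split (D j)  = refl
    build-split (D' j) = refl
    split-build : ∀ p → split (build p) ≡ p
    split-build (zero , j)           = refl
    split-build (suc zero , j)       = refl
    split-build (suc (suc zero) , j) = refl

  symEncoding : FinEncoding Sym (3 * m)
  symEncoding = productEncoding split build build-split split-build
    where
    split : Sym → Fin 3 × Index
    split (S j)  = zero , j
    split (E j)  = suc zero , j
    split (E' j) = suc (suc zero) , j
    build : Fin 3 × Index → Sym
    build (zero , j)           = S j
    build (suc zero , j)       = E j
    build (suc (suc zero) , j) = E' j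
    build-split : ∀ s → build (split s) ≡ s
    build-split (S j)  = refl
    build-split (E j)  = refl
    build-split (E' j) = refl
    split-build : ∀ p → split (build p) ≡ p
    split-build (zero , j)           = refl
    split-build (suc zero , j)       = refl
    split-build (suc (suc zero) , j) = refl

  open FinEncoding rowEncoding public using () renaming (code to rowCode; code-injective to rowCode-injective)
  open FinEncoding colEncoding public using () renaming (code to colCode; code-injective to colCode-injective)
  open FinEncoding symEncoding public using () renaming (code to symCode; code-injective to symCode-injective)

  encode : Cell → Triple
  encode (r , c , s) = rowCode r , colCode c , symCode s

  encode-injective : ∀ {t t′} → encode t ≡ encode t′ → t ≡ t′
  encode-injective {r , c , s} {r′ , c′ , s′} e
    with rowCode-injective {r} {r′} (cong rowOf e) | colCode-injective {c} {c′} (cong colOf e)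
       | symCode-injective {s} {s′} (cong symOf e)
  ... | refl | refl | refl = refl

  cellAt : (Index → Fin 8 → Cell) → Fin (m * 8) → Cell
  cellAt colour k = uncurry colour (remQuot 8 k)

  cellsOf : (Index → Fin 8 → Cell) → List Triple
  cellsOf colour = tabulate (λ k → encode (cellAt colour k))

  W B : List Triple
  W = cellsOf white
  B = cellsOf black

  ∈cellsOf⁺ : ∀ {colour t} → IsCell colour t → encode t ∈ cellsOf colour
  ∈cellsOf⁺ {colour} (j , i , refl) =
    subst (λ p → encode (uncurry colour p) ∈ cellsOf colour) (remQuot-combine j i)
          (∈-tabulate⁺ {f = λ k → encode (cellAt colour k)} (combine j i))

  ∈cellsOf⁻ : ∀ {colour x} → x ∈ cellsOf colour → Σ Cell λ t → IsCell colour t × x ≡ encode t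
  ∈cellsOf⁻ {colour} x∈ with ∈-tabulate⁻ {f = λ k → encode (cellAt colour k)} x∈
  ... | k , refl = cellAt colour k , (proj₁ (remQuot {m} 8 k) , proj₂ (remQuot {m} 8 k) , refl) , refl

  cellsOf-unique : ∀ {colour} (position : Cell → Index × Fin 8) →
    (∀ j i → position (colour j i) ≡ (j , i)) → Unique (cellsOf colour)
  cellsOf-unique {colour} position position-colour =
    Unique.tabulate⁺ {f = λ k → encode (cellAt colour k)} λ {k} {k′} e →
      trans (sym (combine-remQuot {m} 8 k))
        (trans (cong (uncurry combine) (positions≡ (remQuot 8 k) (remQuot 8 k′) (encode-injective e)))
               (combine-remQuot {m} 8 k′))
    where
    positions≡ : ∀ p p′ → uncurry colour p ≡ uncurry colour p′ → p ≡ p′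
    positions≡ (j , i) (j′ , i′) e =
      trans (sym (position-colour j i)) (trans (cong position e) (position-colour j′ i′))

  size-W : size W ≡ 8 * m
  size-W = trans (length-tabulate (λ k → encode (cellAt white k))) (*-comm m 8)

  DeterminedBy : (Row → Col → Cell) → (Row → Sym → Cell) → (Col → Sym → Cell) → Cell → Set
  DeterminedBy rc rs cs t@(r , c , s) = rc r c ≡ t × rs r s ≡ t × cs c s ≡ t

  partialLatin : ∀ {colour} rc rs cs → (∀ j i → DeterminedBy rc rs cs (colour j i)) →
                 PartialLatin (cellsOf colour)
  partialLatin {colour} rc rs cs determined t∈ t′∈ agree
    with ∈cellsOf⁻ {colour} t∈ | ∈cellsOf⁻ {colour} t′∈
  ... | _ , (j , i , refl) , refl | _ , (j′ , i′ , refl) , refl = cong encode (same agree)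
    where
    t = colour j i
    t′ = colour j′ i′
    same : AgreeTwo (encode t) (encode t′) → t ≡ t′
    same (inj₁ (er , ec)) = trans (sym (proj₁ (determined j i)))
      (trans (cong₂ rc (rowCode-injective er) (colCode-injective ec)) (proj₁ (determined j′ i′)))
    same (inj₂ (inj₁ (er , es))) = trans (sym (proj₁ (proj₂ (determined j i))))
      (trans (cong₂ rs (rowCode-injective er) (symCode-injective es)) (proj₁ (proj₂ (determined j′ i′))))
    same (inj₂ (inj₂ (ec , es))) = trans (sym (proj₂ (proj₂ (determined j i))))
      (trans (cong₂ cs (colCode-injective ec) (symCode-injective es)) (proj₂ (proj₂ (determined j′ i′))))

  ifEqual : ∀ {a b : Index} → Dec (a ≡ b) → Cell → Cell → Cell
  ifEqual (yes _) t t′ = t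
  ifEqual (no _)  t t′ = t′

  ifEqual-refl : ∀ {a : Index} (d : Dec (a ≡ a)) t t′ → ifEqual d t t′ ≡ t
  ifEqual-refl (yes _) t t′ = refl
  ifEqual-refl (no a≢a) t t′ = ⊥-elim (a≢a refl)

  ifEqual-≢ : ∀ {a b : Index} → ¬ a ≡ b → (d : Dec (a ≡ b)) → ∀ t t′ → ifEqual d t t′ ≡ t′
  ifEqual-≢ a≢b (yes a≡b) t t′ = ⊥-elim (a≢b a≡b)
  ifEqual-≢ a≢b (no _)    t t′ = refl

  -- decoders for the white cells
  whiteRC : Row → Col → Cell
  whiteRC P      (C k)  = P , C k , E k
  whiteRC P      (D k)  = P , D k , S k
  whiteRC (A j)  (C k)  = A j , C k , S j
  whiteRC (A j)  (D k)  = A j , D k , E j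
  whiteRC Q      (C k)  = Q , C k , E' (prev k)
  whiteRC Q      (D' k) = Q , D' k , S k
  whiteRC (A' j) (C k)  = A' j , C k , S j
  whiteRC (A' j) (D' k) = A' j , D' k , E' j
  whiteRC r      c      = r , c , S zero

  whiteRS : Row → Sym → Cell
  whiteRS P      (E k)  = P , C k , E k
  whiteRS P      (S k)  = P , D k , S k
  whiteRS (A j)  (S k)  = A j , C j , S k
  whiteRS (A j)  (E k)  = A j , D j , E k
  whiteRS Q      (E' k) = Q , C (next k) , E' k
  whiteRS Q      (S k)  = Q , D' k , S k
  whiteRS (A' j) (S k)  = A' j , C (next j) , S k
  whiteRS (A' j) (E' k) = A' j , D' j , E' k
  whiteRS r      s      = r , C zero , s

  whiteCS : Col → Sym → Cell
  whiteCS (C k)  (E j)  = P , C k , E j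
  whiteCS (D k)  (S j)  = P , D k , S j
  whiteCS (C k)  (S j)  = ifEqual (k ≟ᶠ j) (A j , C k , S j) (A' j , C k , S j)
  whiteCS (D k)  (E j)  = A k , D k , E j
  whiteCS (C k)  (E' j) = Q , C k , E' j
  whiteCS (D' k) (S j)  = Q , D' k , S j
  whiteCS (D' k) (E' j) = A' k , D' k , E' j
  whiteCS c      s      = P , c , s

  blackRC : Row → Col → Cell
  blackRC P      (C k)  = P , C k , S (prev k)
  blackRC Q      (C k)  = Q , C k , S k
  blackRC P      (D k)  = P , D k , E k
  blackRC (A j)  (C k)  = A j , C k , E j
  blackRC (A j)  (D k)  = A j , D k , S j
  blackRC Q      (D' k) = Q , D' k , E' k
  blackRC (A' j) (C k)  = A' j , C k , E' j
  blackRC (A' j) (D' k) = A' j , D' k , S j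
  blackRC r      c      = r , c , S zero

  blackRS : Row → Sym → Cell
  blackRS P      (S k)  = P , C (next k) , S k
  blackRS Q      (S k)  = Q , C k , S k
  blackRS P      (E k)  = P , D k , E k
  blackRS (A j)  (E k)  = A j , C j , E k
  blackRS (A j)  (S k)  = A j , D j , S k
  blackRS Q      (E' k) = Q , D' k , E' k
  blackRS (A' j) (E' k) = A' j , C (next j) , E' k
  blackRS (A' j) (S k)  = A' j , D' j , S k
  blackRS r      s      = r , C zero , s

  blackCS : Col → Sym → Cell
  blackCS (C k)  (S j)  = ifEqual (k ≟ᶠ j) (Q , C k , S j) (P , C k , S j)
  blackCS (D k)  (E j)  = P , D k , E j
  blackCS (C k)  (E j)  = A k , C k , E j
  blackCS (D k)  (S j)  = A k , D k , S j
  blackCS (D' k) (E' j) = Q , D' k , E' j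
  blackCS (C k)  (E' j) = A' j , C k , E' j
  blackCS (D' k) (S j)  = A' k , D' k , S j
  blackCS c      s      = P , c , s

  whiteDetermined : ∀ j i → DeterminedBy whiteRC whiteRS whiteCS (white j i)
  whiteDetermined j zero = refl , refl , refl
  whiteDetermined j (suc zero) = refl , refl , refl
  whiteDetermined j (suc (suc zero)) = refl , refl , ifEqual-refl (j ≟ᶠ j) _ _
  whiteDetermined j (suc (suc (suc zero))) = refl , refl , refl
  whiteDetermined j (suc (suc (suc (suc zero)))) =
    cong (λ k → Q , C (next j) , E' k) (prev-next j) , refl , refl
  whiteDetermined j (suc (suc (suc (suc (suc zero))))) = refl , refl , refl
  whiteDetermined j (suc (suc (suc (suc (suc (suc zero)))))) =
    refl , refl , ifEqual-≢ (next≢ j) (next j ≟ᶠ j) _ _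
  whiteDetermined j (suc (suc (suc (suc (suc (suc (suc zero))))))) = refl , refl , refl

  blackDetermined : ∀ j i → DeterminedBy blackRC blackRS blackCS (black j i)
  blackDetermined j zero =
    cong (λ k → P , C (next j) , S k) (prev-next j) , refl , ifEqual-≢ (next≢ j) (next j ≟ᶠ j) _ _
  blackDetermined j (suc zero) = refl , refl , ifEqual-refl (j ≟ᶠ j) _ _
  blackDetermined j (suc (suc zero)) = refl , refl , refl
  blackDetermined j (suc (suc (suc zero))) = refl , refl , refl
  blackDetermined j (suc (suc (suc (suc zero)))) = refl , refl , refl
  blackDetermined j (suc (suc (suc (suc (suc zero))))) = refl , refl , refl
  blackDetermined j (suc (suc (suc (suc (suc (suc zero)))))) = refl , refl , refl
  blackDetermined j (suc (suc (suc (suc (suc (suc (suc zero))))))) = refl , refl , refl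

  latinW : PartialLatin W
  latinW = partialLatin whiteRC whiteRS whiteCS whiteDetermined

  latinB : PartialLatin B
  latinB = partialLatin blackRC blackRS blackCS blackDetermined

  at : ∀ {colour} j i → IsCell colour (colour j i)
  at j i = j , i , refl

  HasMates : (Cell → Set) → Cell → Set
  HasMates U (r , c , s) =
    (Σ Row λ r′ → ¬ r′ ≡ r × U (r′ , c , s)) ×
    (Σ Col λ c′ → ¬ c′ ≡ c × U (r , c′ , s)) ×
    (Σ Sym λ s′ → ¬ s′ ≡ s × U (r , c , s′))

  whiteMates : ∀ j i → HasMates (IsCell black) (white j i)
  whiteMates j zero = (A j , (λ ()) , at j c₃) , (D j , (λ ()) , at j c₂) ,
    (S (prev j) , (λ ()) , prev j , c₀ , cong (λ k → P , C k , S (prev j)) (next-prev j))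
  whiteMates j (suc zero) = (A j , (λ ()) , at j c₄) , (C (next j) , (λ ()) , at j c₀) , (E j , (λ ()) , at j c₂)
  whiteMates j (suc (suc zero)) = (Q , (λ ()) , at j c₁) , (D j , (λ ()) , at j c₄) , (E j , (λ ()) , at j c₃)
  whiteMates j (suc (suc (suc zero))) = (P , (λ ()) , at j c₂) , (C j , (λ ()) , at j c₃) , (S j , (λ ()) , at j c₄)
  whiteMates j (suc (suc (suc (suc zero)))) =
    (A' j , (λ ()) , at j c₆) , (D' j , (λ ()) , at j c₅) , (S (next j) , (λ ()) , at (next j) c₁)
  whiteMates j (suc (suc (suc (suc (suc zero))))) =
    (A' j , (λ ()) , at j c₇) , (C j , (λ ()) , at j c₁) , (E' j , (λ ()) , at j c₅)
  whiteMates j (suc (suc (suc (suc (suc (suc zero)))))) =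
    (P , (λ ()) , at j c₀) , (D' j , (λ ()) , at j c₇) , (E' j , (λ ()) , at j c₆)
  whiteMates j (suc (suc (suc (suc (suc (suc (suc zero))))))) =
    (Q , (λ ()) , at j c₅) , (C (next j) , (λ ()) , at j c₆) , (S j , (λ ()) , at j c₇)

  blackMates : ∀ j i → HasMates (IsCell white) (black j i)
  blackMates j zero = (A' j , (λ ()) , at j c₆) , (D j , (λ ()) , at j c₁) , (E (next j) , (λ ()) , at (next j) c₀)
  blackMates j (suc zero) = (A j , (λ ()) , at j c₂) , (D' j , (λ ()) , at j c₅) ,
    (E' (prev j) , (λ ()) , prev j , c₄ , cong (λ k → Q , C k , E' (prev j)) (next-prev j))
  blackMates j (suc (suc zero)) = (A j , (λ ()) , at j c₃) , (C j , (λ ()) , at j c₀) , (S j , (λ ()) , at j c₁)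
  blackMates j (suc (suc (suc zero))) = (P , (λ ()) , at j c₀) , (D j , (λ ()) , at j c₃) , (S j , (λ ()) , at j c₂)
  blackMates j (suc (suc (suc (suc zero)))) = (P , (λ ()) , at j c₁) , (C j , (λ ()) , at j c₂) , (E j , (λ ()) , at j c₃)
  blackMates j (suc (suc (suc (suc (suc zero))))) =
    (A' j , (λ ()) , at j c₇) , (C (next j) , (λ ()) , at j c₄) , (S j , (λ ()) , at j c₅)
  blackMates j (suc (suc (suc (suc (suc (suc zero)))))) =
    (Q , (λ ()) , at j c₄) , (D' j , (λ ()) , at j c₇) , (S j , (λ ()) , at j c₆)
  blackMates j (suc (suc (suc (suc (suc (suc (suc zero))))))) =
    (Q , (λ ()) , at j c₅) , (C (next j) , (λ ()) , at j c₆) , (E' j , (λ ()) , at j c₇)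

  -- Abstract mates give the mates of the statement; they are unique because
  -- the cells of the other colour form a partial latin square.
  mates : ∀ {colour colour′} → (∀ j i → HasMates (IsCell colour′) (colour j i)) →
          PartialLatin (cellsOf colour′) → Mates (cellsOf colour) (cellsOf colour′)
  mates {colour} {colour′} hasMates latin x∈ with ∈cellsOf⁻ {colour} x∈
  ... | _ , (j , i , refl) , refl with hasMates j i
  ... | (r′ , r′≢ , r′∈) , (c′ , c′≢ , c′∈) , (s′ , s′≢ , s′∈) =
    (rowCode r′ , ((λ e → r′≢ (rowCode-injective e)) , ∈cellsOf⁺ r′∈) ,
      λ x′ (_ , x′∈) → cong rowOf (latin (∈cellsOf⁺ r′∈) x′∈ (inj₂ (inj₂ (refl , refl))))) ,
    (colCode c′ , ((λ e → c′≢ (colCode-injective e)) , ∈cellsOf⁺ c′∈) ,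
      λ y′ (_ , y′∈) → cong colOf (latin (∈cellsOf⁺ c′∈) y′∈ (inj₂ (inj₁ (refl , refl))))) ,
    (symCode s′ , ((λ e → s′≢ (symCode-injective e)) , ∈cellsOf⁺ s′∈) ,
      λ z′ (_ , z′∈) → cong symOf (latin (∈cellsOf⁺ s′∈) z′∈ (inj₁ (refl , refl))))

  latinBitrade : LatinBitrade W B
  latinBitrade =
    (_ , ∈cellsOf⁺ (at {white} zero c₀)) , (_ , ∈cellsOf⁺ (at {black} zero c₀)) ,
    cellsOf-unique positionOfWhite positionOfWhite-white ,
    cellsOf-unique positionOfBlack positionOfBlack-black ,
    latinW , latinB , mates whiteMates latinB , mates blackMates latinW

  rowWitness : ∀ r → Σ Cell λ t → IsCell white t × proj₁ t ≡ r
  rowWitness P      = _ , at zero c₀ , refl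
  rowWitness Q      = _ , at zero c₄ , refl
  rowWitness (A j)  = _ , at j c₂ , refl
  rowWitness (A' j) = _ , at j c₆ , refl

  colWitness : ∀ c → Σ Cell λ t → IsCell white t × proj₁ (proj₂ t) ≡ c
  colWitness (C j)  = _ , at j c₀ , refl
  colWitness (D j)  = _ , at j c₁ , refl
  colWitness (D' j) = _ , at j c₅ , refl

  symWitness : ∀ s → Σ Cell λ t → IsCell white t × proj₂ (proj₂ t) ≡ s
  symWitness (S j)  = _ , at j c₁ , refl
  symWitness (E j)  = _ , at j c₀ , refl
  symWitness (E' j) = _ , at j c₄ , refl

  usedLabel : ∀ (coord : Triple → ℕ) {x} → x ∈ deduplicate _≟_ (map coord W) →
              Σ Cell λ t → IsCell white t × x ≡ coord (encode t)
  usedLabel coord x∈ with ∈-map⁻ coord (∈-deduplicate⁻ _≟_ (map coord W) x∈)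
  ... | _ , t∈ , refl with ∈cellsOf⁻ {white} t∈
  ... | t , w , refl = t , w , refl

  countLabels : ∀ {L N} (enc : FinEncoding L N) (coord : Triple → ℕ) (label : Cell → L) →
    (∀ t → coord (encode t) ≡ FinEncoding.code enc (label t)) →
    (∀ l → Σ Cell λ t → IsCell white t × label t ≡ l) →
    length (deduplicate _≟_ (map coord W)) ≡ N
  countLabels {N = N} enc coord label coord-encode witness = countDistinct N (map coord W)
    (λ x∈ → let (t , _ , x≡) = usedLabel coord (∈-deduplicate⁺ _≟_ x∈) in
            subst (_< N) (sym (trans x≡ (coord-encode t))) (code< (label t)))
    (λ x<N → let (l , l≡x) = code-surjective x<N
                 (t , w , t≡l) = witness l in
             subst (_∈ map coord W) (trans (coord-encode t) (trans (cong code t≡l) l≡x))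
                   (∈-map⁺ coord (∈cellsOf⁺ w)))
    where open FinEncoding enc

  euler : 2 + size W ≡ length (Rows W) + length (Cols W) + length (Syms W)
  euler = begin
    2 + size W                      ≡⟨ cong (2 +_) size-W ⟩
    2 + 8 * m                       ≡⟨ arithmetic m ⟩
    2 * suc m + 3 * m + 3 * m       ≡⟨ sym (cong₂ _+_ (cong₂ _+_ rows cols) syms) ⟩
    length (Rows W) + length (Cols W) + length (Syms W) ∎
    where
    open ≡-Reasoning
    arithmetic : ∀ m → 2 + 8 * m ≡ 2 * suc m + 3 * m + 3 * m
    arithmetic = solve-∀
    rows : length (Rows W) ≡ 2 * suc m
    rows = countLabels rowEncoding rowOf proj₁ (λ _ → refl) rowWitness
    cols : length (Cols W) ≡ 3 * m
    cols = countLabels colEncoding colOf (λ t → proj₁ (proj₂ t)) (λ _ → refl) colWitness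
    syms : length (Syms W) ≡ 3 * m
    syms = countLabels symEncoding symOf (λ t → proj₂ (proj₂ t)) (λ _ → refl) symWitness

  RowDom : Row → Sym → Set
  RowDom r s = Σ Col λ c → IsCell white (r , c , s)
  RowStep : Row → Sym → Sym → Set
  RowStep r s s′ = Σ Col λ c → IsCell white (r , c , s) × IsCell black (r , c , s′)

  ColDom : Col → Row → Set
  ColDom c r = Σ Sym λ s → IsCell white (r , c , s)
  ColStep : Col → Row → Row → Set
  ColStep c r r′ = Σ Sym λ s → IsCell white (r , c , s) × IsCell black (r′ , c , s)

  SymDom : Sym → Col → Set
  SymDom s c = Σ Row λ r → IsCell white (r , c , s)
  SymStep : Sym → Col → Col → Set
  SymStep s c c′ = Σ Row λ r → IsCell white (r , c , s) × IsCell black (r , c′ , s)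

  whitesInP : ∀ {c s} → IsCell white (P , c , s) → Σ Index λ j → s ≡ E j ⊎ s ≡ S j
  whitesInP (j , zero , refl) = j , inj₁ refl
  whitesInP (j , suc zero , refl) = j , inj₂ refl
  whitesInP (j , suc (suc zero) , ())
  whitesInP (j , suc (suc (suc zero)) , ())
  whitesInP (j , suc (suc (suc (suc zero))) , ())
  whitesInP (j , suc (suc (suc (suc (suc zero)))) , ())
  whitesInP (j , suc (suc (suc (suc (suc (suc zero))))) , ())
  whitesInP (j , suc (suc (suc (suc (suc (suc (suc zero)))))) , ())

  whitesInQ : ∀ {c s} → IsCell white (Q , c , s) → Σ Index λ j → s ≡ E' j ⊎ s ≡ S j
  whitesInQ (j , zero , ())
  whitesInQ (j , suc zero , ())
  whitesInQ (j , suc (suc zero) , ())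
  whitesInQ (j , suc (suc (suc zero)) , ())
  whitesInQ (j , suc (suc (suc (suc zero))) , refl) = j , inj₁ refl
  whitesInQ (j , suc (suc (suc (suc (suc zero)))) , refl) = j , inj₂ refl
  whitesInQ (j , suc (suc (suc (suc (suc (suc zero))))) , ())
  whitesInQ (j , suc (suc (suc (suc (suc (suc (suc zero)))))) , ())

  whitesInA : ∀ {k c s} → IsCell white (A k , c , s) → s ≡ S k ⊎ s ≡ E k
  whitesInA (j , zero , ())
  whitesInA (j , suc zero , ())
  whitesInA (j , suc (suc zero) , refl) = inj₁ refl
  whitesInA (j , suc (suc (suc zero)) , refl) = inj₂ refl
  whitesInA (j , suc (suc (suc (suc zero))) , ())
  whitesInA (j , suc (suc (suc (suc (suc zero)))) , ())
  whitesInA (j , suc (suc (suc (suc (suc (suc zero))))) , ())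
  whitesInA (j , suc (suc (suc (suc (suc (suc (suc zero)))))) , ())

  whitesInA' : ∀ {k c s} → IsCell white (A' k , c , s) → s ≡ S k ⊎ s ≡ E' k
  whitesInA' (j , zero , ())
  whitesInA' (j , suc zero , ())
  whitesInA' (j , suc (suc zero) , ())
  whitesInA' (j , suc (suc (suc zero)) , ())
  whitesInA' (j , suc (suc (suc (suc zero))) , ())
  whitesInA' (j , suc (suc (suc (suc (suc zero)))) , ())
  whitesInA' (j , suc (suc (suc (suc (suc (suc zero))))) , refl) = inj₁ refl
  whitesInA' (j , suc (suc (suc (suc (suc (suc (suc zero)))))) , refl) = inj₂ refl

  whitesInC : ∀ {k r s} → IsCell white (r , C k , s) → r ≡ P ⊎ r ≡ A k ⊎ r ≡ Q ⊎ r ≡ A' (prev k)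
  whitesInC (j , zero , refl) = inj₁ refl
  whitesInC (j , suc zero , ())
  whitesInC (j , suc (suc zero) , refl) = inj₂ (inj₁ refl)
  whitesInC (j , suc (suc (suc zero)) , ())
  whitesInC (j , suc (suc (suc (suc zero))) , refl) = inj₂ (inj₂ (inj₁ refl))
  whitesInC (j , suc (suc (suc (suc (suc zero)))) , ())
  whitesInC (j , suc (suc (suc (suc (suc (suc zero))))) , refl) =
    inj₂ (inj₂ (inj₂ (cong A' (sym (prev-next j)))))
  whitesInC (j , suc (suc (suc (suc (suc (suc (suc zero)))))) , ())

  whitesInD : ∀ {k r s} → IsCell white (r , D k , s) → r ≡ P ⊎ r ≡ A k
  whitesInD (j , zero , ())
  whitesInD (j , suc zero , refl) = inj₁ refl
  whitesInD (j , suc (suc zero) , ())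
  whitesInD (j , suc (suc (suc zero)) , refl) = inj₂ refl
  whitesInD (j , suc (suc (suc (suc zero))) , ())
  whitesInD (j , suc (suc (suc (suc (suc zero)))) , ())
  whitesInD (j , suc (suc (suc (suc (suc (suc zero))))) , ())
  whitesInD (j , suc (suc (suc (suc (suc (suc (suc zero)))))) , ())

  whitesInD' : ∀ {k r s} → IsCell white (r , D' k , s) → r ≡ Q ⊎ r ≡ A' k
  whitesInD' (j , zero , ())
  whitesInD' (j , suc zero , ())
  whitesInD' (j , suc (suc zero) , ())
  whitesInD' (j , suc (suc (suc zero)) , ())
  whitesInD' (j , suc (suc (suc (suc zero))) , ())
  whitesInD' (j , suc (suc (suc (suc (suc zero)))) , refl) = inj₁ refl
  whitesInD' (j , suc (suc (suc (suc (suc (suc zero))))) , ())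
  whitesInD' (j , suc (suc (suc (suc (suc (suc (suc zero)))))) , refl) = inj₂ refl

  whitesInS : ∀ {k r c} → IsCell white (r , c , S k) → c ≡ D k ⊎ c ≡ C (next k) ⊎ c ≡ D' k ⊎ c ≡ C k
  whitesInS (j , zero , ())
  whitesInS (j , suc zero , refl) = inj₁ refl
  whitesInS (j , suc (suc zero) , refl) = inj₂ (inj₂ (inj₂ refl))
  whitesInS (j , suc (suc (suc zero)) , ())
  whitesInS (j , suc (suc (suc (suc zero))) , ())
  whitesInS (j , suc (suc (suc (suc (suc zero)))) , refl) = inj₂ (inj₂ (inj₁ refl))
  whitesInS (j , suc (suc (suc (suc (suc (suc zero))))) , refl) = inj₂ (inj₁ refl)
  whitesInS (j , suc (suc (suc (suc (suc (suc (suc zero)))))) , ())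

  whitesInE : ∀ {k r c} → IsCell white (r , c , E k) → c ≡ C k ⊎ c ≡ D k
  whitesInE (j , zero , refl) = inj₁ refl
  whitesInE (j , suc zero , ())
  whitesInE (j , suc (suc zero) , ())
  whitesInE (j , suc (suc (suc zero)) , refl) = inj₂ refl
  whitesInE (j , suc (suc (suc (suc zero))) , ())
  whitesInE (j , suc (suc (suc (suc (suc zero)))) , ())
  whitesInE (j , suc (suc (suc (suc (suc (suc zero))))) , ())
  whitesInE (j , suc (suc (suc (suc (suc (suc (suc zero)))))) , ())

  whitesInE' : ∀ {k r c} → IsCell white (r , c , E' k) → c ≡ C (next k) ⊎ c ≡ D' k
  whitesInE' (j , zero , ())
  whitesInE' (j , suc zero , ())
  whitesInE' (j , suc (suc zero) , ())
  whitesInE' (j , suc (suc (suc zero)) , ())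
  whitesInE' (j , suc (suc (suc (suc zero))) , refl) = inj₁ refl
  whitesInE' (j , suc (suc (suc (suc (suc zero)))) , ())
  whitesInE' (j , suc (suc (suc (suc (suc (suc zero))))) , ())
  whitesInE' (j , suc (suc (suc (suc (suc (suc (suc zero)))))) , refl) = inj₂ refl

  -- Rows P and Q are long cycles S j → E j → S (prev j) and
  -- S j → E' j → S (next j); the other lines are short cycles.
  rowCycle : ∀ r → CycleOn (RowDom r) (RowStep r)
  rowCycle P = threadedCycle prev S prev-connected zero
    (λ j → (D j , at j c₁ , at j c₂) ◅ (C j , at j c₀ , blackP j) ◅ ε) into outOf
    where
    blackP : ∀ j → IsCell black (P , C j , S (prev j))
    blackP j = prev j , c₀ , cong (λ k → P , C k , S (prev j)) (next-prev j)
    into : ∀ s → RowDom P s → Σ Index λ j → Star (RowStep P) s (S j)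
    into s (c , w) with whitesInP w
    ... | j , inj₁ refl = prev j , (C j , at j c₀ , blackP j) ◅ ε
    ... | j , inj₂ refl = j , ε
    outOf : ∀ s → RowDom P s → Σ Index λ j → Star (RowStep P) (S j) s
    outOf s (c , w) with whitesInP w
    ... | j , inj₁ refl = j , (D j , at j c₁ , at j c₂) ◅ ε
    ... | j , inj₂ refl = j , ε
  rowCycle Q = threadedCycle next S next-connected zero
    (λ j → (D' j , at j c₅ , at j c₅) ◅ (C (next j) , at j c₄ , at (next j) c₁) ◅ ε) into outOf
    where
    into : ∀ s → RowDom Q s → Σ Index λ j → Star (RowStep Q) s (S j)
    into s (c , w) with whitesInQ w
    ... | j , inj₁ refl = next j , (C (next j) , at j c₄ , at (next j) c₁) ◅ ε
    ... | j , inj₂ refl = j , ε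
    outOf : ∀ s → RowDom Q s → Σ Index λ j → Star (RowStep Q) (S j) s
    outOf s (c , w) with whitesInQ w
    ... | j , inj₁ refl = j , (D' j , at j c₅ , at j c₅) ◅ ε
    ... | j , inj₂ refl = j , ε
  rowCycle (A k) = twoCycle (S k) (E k) (C k , at k c₂ , at k c₃) (D k , at k c₃ , at k c₄)
    (λ s (c , w) → whitesInA w)
  rowCycle (A' k) = twoCycle (S k) (E' k) (C (next k) , at k c₆ , at k c₆) (D' k , at k c₇ , at k c₇)
    (λ s (c , w) → whitesInA' w)

  colCycle : ∀ c → CycleOn (ColDom c) (ColStep c)
  colCycle (C k) = fourCycle P (A k) Q (A' (prev k))
    (E k , at k c₀ , at k c₃) (S k , at k c₂ , at k c₁)
    (E' (prev k) , (prev k , c₄ , shifted (λ z → Q , C z , E' (prev k))) ,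
                   (prev k , c₆ , shifted (λ z → A' (prev k) , C z , E' (prev k))))
    (S (prev k) , (prev k , c₆ , shifted (λ z → A' (prev k) , C z , S (prev k))) ,
                  (prev k , c₀ , shifted (λ z → P , C z , S (prev k))))
    (λ r (s , w) → whitesInC w)
    where
    shifted : (f : Index → Cell) → f (next (prev k)) ≡ f k
    shifted f = cong f (next-prev k)
  colCycle (D k) = twoCycle P (A k) (S k , at k c₁ , at k c₄) (E k , at k c₃ , at k c₂)
    (λ r (s , w) → whitesInD w)
  colCycle (D' k) = twoCycle Q (A' k) (S k , at k c₅ , at k c₇) (E' k , at k c₇ , at k c₅)
    (λ r (s , w) → whitesInD' w)

  symCycle : ∀ s → CycleOn (SymDom s) (SymStep s)
  symCycle (S k) = fourCycle (D k) (C (next k)) (D' k) (C k)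
    (P , at k c₁ , at k c₀) (A' k , at k c₆ , at k c₇) (Q , at k c₅ , at k c₁) (A k , at k c₂ , at k c₄)
    (λ c (r , w) → whitesInS w)
  symCycle (E k) = twoCycle (C k) (D k) (P , at k c₀ , at k c₂) (A k , at k c₃ , at k c₃)
    (λ c (r , w) → whitesInE w)
  symCycle (E' k) = twoCycle (C (next k)) (D' k) (Q , at k c₄ , at k c₅) (A' k , at k c₇ , at k c₆)
    (λ c (r , w) → whitesInE' w)

  separated : Separated W B
  separated = rows , cols , syms
    where
    rows : ∀ x → x ∈ Rows W → SingleCycle (rowDom W x) (rowPerm W B x)
    rows x x∈ with usedLabel rowOf x∈
    ... | (r , _ , _) , _ , refl =
      transferCycle symCode (λ (c , w , b) → colCode c , ∈cellsOf⁺ w , ∈cellsOf⁺ b) decode (rowCycle r)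
      where
      decode : ∀ {z} → rowDom W (rowCode r) z → Σ Sym λ s → z ≡ symCode s × RowDom r s
      decode (_ , t∈) with ∈cellsOf⁻ {white} t∈
      ... | (r′ , c , s) , w , e with rowCode-injective {r} {r′} (cong rowOf e)
      ... | refl = s , cong symOf e , c , w

    cols : ∀ y → y ∈ Cols W → SingleCycle (colDom W y) (colPerm W B y)
    cols y y∈ with usedLabel colOf y∈
    ... | (_ , c , _) , _ , refl =
      transferCycle rowCode (λ (s , w , b) → symCode s , ∈cellsOf⁺ w , ∈cellsOf⁺ b) decode (colCycle c)
      where
      decode : ∀ {x} → colDom W (colCode c) x → Σ Row λ r → x ≡ rowCode r × ColDom c r
      decode (_ , t∈) with ∈cellsOf⁻ {white} t∈
      ... | (r , c′ , s) , w , e with colCode-injective {c} {c′} (cong colOf e)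
      ... | refl = r , cong rowOf e , s , w

    syms : ∀ z → z ∈ Syms W → SingleCycle (symDom W z) (symPerm W B z)
    syms z z∈ with usedLabel symOf z∈
    ... | (_ , _ , s) , _ , refl =
      transferCycle colCode (λ (r , w , b) → rowCode r , ∈cellsOf⁺ w , ∈cellsOf⁺ b) decode (symCycle s)
      where
      decode : ∀ {y} → symDom W (symCode s) y → Σ Col λ c → y ≡ colCode c × SymDom s c
      decode (_ , t∈) with ∈cellsOf⁻ {white} t∈
      ... | (r , c , s′) , w , e with symCode-injective {s} {s′} (cong symOf e)
      ... | refl = c , cong colOf e , r , w

  data Linked : Triple → Set where
    start : Linked (encode (white zero c₀))
    link : ∀ {t t′ b} → Linked t → b ∈ B → AgreeTwo t b → AgreeTwo t′ b → t′ ∈ W → Linked t′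

  sameRowCol : ∀ {x y z z′} → AgreeTwo (x , y , z) (x , y , z′)
  sameRowCol = inj₁ (refl , refl)
  sameRowSym : ∀ {x y y′ z} → AgreeTwo (x , y , z) (x , y′ , z)
  sameRowSym = inj₂ (inj₁ (refl , refl))
  sameColSym : ∀ {x x′ y z} → AgreeTwo (x , y , z) (x′ , y , z)
  sameColSym = inj₂ (inj₂ (refl , refl))

  agree-sym : ∀ {t u} → AgreeTwo t u → AgreeTwo u t
  agree-sym (inj₁ (e , f))        = inj₁ (sym e , sym f)
  agree-sym (inj₂ (inj₁ (e , f))) = inj₂ (inj₁ (sym e , sym f))
  agree-sym (inj₂ (inj₂ (e , f))) = inj₂ (inj₂ (sym e , sym f))

  -- In a latin bitrade (T₁, U₁) inside a partial latin square U, a cell of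
  -- U agreeing with a cell of T₁ in two coordinates is its mate, so lies in U₁.
  mateClosed : ∀ {T₁ U₁ U : List Triple} → Mates T₁ U₁ → PartialLatin U → (∀ {u} → u ∈ U₁ → u ∈ U) →
               ∀ {t u} → t ∈ T₁ → u ∈ U → AgreeTwo t u → u ∈ U₁
  mateClosed {U₁ = U₁} mates latin U₁⊆U {_ , _ , _} t∈ u∈ (inj₁ agree) with mates t∈
  ... | _ , _ , (_ , (_ , m∈) , _) = subst (_∈ U₁) (latin (U₁⊆U m∈) u∈ (inj₁ agree)) m∈
  mateClosed {U₁ = U₁} mates latin U₁⊆U {_ , _ , _} t∈ u∈ (inj₂ (inj₁ agree)) with mates t∈
  ... | _ , (_ , (_ , m∈) , _) , _ = subst (_∈ U₁) (latin (U₁⊆U m∈) u∈ (inj₂ (inj₁ agree))) m∈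
  mateClosed {U₁ = U₁} mates latin U₁⊆U {_ , _ , _} t∈ u∈ (inj₂ (inj₂ agree)) with mates t∈
  ... | (_ , (_ , m∈) , _) , _ , _ = subst (_∈ U₁) (latin (U₁⊆U m∈) u∈ (inj₂ (inj₂ agree))) m∈

  linkedIn : ∀ {W₁ B₁} → LatinBitrade W₁ B₁ → (∀ {t} → t ∈ W₁ → t ∈ W) → (∀ {t} → t ∈ B₁ → t ∈ B) →
             encode (white zero c₀) ∈ W₁ → ∀ {t} → Linked t → t ∈ W₁
  linkedIn _ _ _ start∈ start = start∈
  linkedIn bitrade@(_ , _ , _ , _ , _ , _ , matesWB₁ , matesBW₁) W₁⊆W B₁⊆B start∈ (link l b∈ agree agree′ t′∈) =
    mateClosed matesBW₁ latinW W₁⊆W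
      (mateClosed matesWB₁ latinB B₁⊆B (linkedIn bitrade W₁⊆W B₁⊆B start∈ l) b∈ agree)
      t′∈ (agree-sym agree′)

  linkBlock : ∀ j → Linked (encode (white j c₀)) →
              (∀ i → Linked (encode (white j i))) × Linked (encode (white (next j) c₀))
  linkBlock j l₀ = linked , l₈
    where
    via : ∀ {i} → Linked (encode (white j i)) → ∀ j′ b → AgreeTwo (encode (white j i)) (encode (black j′ b)) →
          ∀ {t} → IsCell white t → AgreeTwo (encode t) (encode (black j′ b)) → Linked (encode t)
    via l j′ b agree w agree′ = link l (∈cellsOf⁺ (at {black} j′ b)) agree agree′ (∈cellsOf⁺ w)
    l₁ : Linked (encode (white j c₁))
    l₂ : Linked (encode (white j c₂))
    l₃ : Linked (encode (white j c₃))
    l₄ : Linked (encode (white j c₄))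
    l₅ : Linked (encode (white j c₅))
    l₆ : Linked (encode (white j c₆))
    l₇ : Linked (encode (white j c₇))
    l₁ = via {c₀} l₀ j c₂ sameRowSym (at j c₁) sameRowCol
    l₂ = via {c₀} l₀ j c₃ sameColSym (at j c₂) sameRowCol
    l₃ = via {c₀} l₀ j c₂ sameRowSym (at j c₃) sameColSym
    l₅ = via {c₂} l₂ j c₁ sameColSym (at j c₅) sameRowSym
    l₄ = via {c₅} l₅ j c₅ sameRowCol (at j c₄) sameRowSym
    l₆ = via {c₅} l₅ j c₇ sameColSym (at j c₆) sameRowSym
    l₇ = via {c₅} l₅ j c₅ sameRowCol (at j c₇) sameColSym
    l₈ : Linked (encode (white (next j) c₀))
    l₈ = via {c₁} l₁ j c₀ sameRowSym (at (next j) c₀) sameRowCol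
    linked : ∀ i → Linked (encode (white j i))
    linked zero = l₀
    linked (suc zero) = l₁
    linked (suc (suc zero)) = l₂
    linked (suc (suc (suc zero))) = l₃
    linked (suc (suc (suc (suc zero)))) = l₄
    linked (suc (suc (suc (suc (suc zero))))) = l₅
    linked (suc (suc (suc (suc (suc (suc zero)))))) = l₆
    linked (suc (suc (suc (suc (suc (suc (suc zero))))))) = l₇

  allLinked : ∀ {t} → t ∈ W → Linked t
  allLinked t∈ with ∈cellsOf⁻ {white} t∈
  ... | _ , (j , i , refl) , refl = proj₁ (linkBlock j (firstLinked j)) i
    where
    firstLinked : ∀ j → Linked (encode (white j c₀))
    firstLinked = <-weakInduction (λ j → Linked (encode (white j c₀))) start
      λ i l → subst (λ k → Linked (encode (white k c₀))) (next-inject₁ i) (proj₂ (linkBlock _ l))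

  -- If W were split between two latin bitrades, the one containing the first
  -- white cell would contain every white cell, leaving the other empty.
  connected : Connected W B
  connected (W₁ , B₁ , W₂ , B₂ , bitrade₁ , bitrade₂ , disjoint , W≈ , B≈)
    with ∈-++⁻ W₁ (proj₁ (W≈ _) (∈cellsOf⁺ (at {white} zero c₀)))
  ... | inj₁ start∈W₁ = let (u , u∈W₂) = proj₁ bitrade₂ in
    disjoint u (linkedIn bitrade₁ (λ p → proj₂ (W≈ _) (∈-++⁺ˡ p)) (λ p → proj₂ (B≈ _) (∈-++⁺ˡ p)) start∈W₁
                 (allLinked (proj₂ (W≈ u) (∈-++⁺ʳ W₁ u∈W₂)))) u∈W₂
  ... | inj₂ start∈W₂ = let (u , u∈W₁) = proj₁ bitrade₁ in
    disjoint u u∈W₁ (linkedIn bitrade₂ (λ p → proj₂ (W≈ _) (∈-++⁺ʳ W₁ p)) (λ p → proj₂ (B≈ _) (∈-++⁺ʳ B₁ p))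
                      start∈W₂ (allLinked (proj₂ (W≈ u) (∈-++⁺ˡ u∈W₁))))

  planar : Planar W B
  planar = separated , connected , euler

  -- For an embedding (f, h, k) of W the m + 1 elements
  -- f(P) - f(P) = 0 and f(A j) - f(P) are distinct and have order at most
  -- two, since f(A j) - f(P) = k(S j) - k(E j) (columns C j) and
  -- f(A j) - f(P) = k(E j) - k(S j) (columns D j).
  distinguishedRow : Fin (suc m) → Row
  distinguishedRow zero    = P
  distinguishedRow (suc j) = A j

  distinguishedRow-injective : ∀ {i i′} → distinguishedRow i ≡ distinguishedRow i′ → i ≡ i′
  distinguishedRow-injective {zero}  {zero}   _    = refl
  distinguishedRow-injective {suc j} {suc j′} refl = refl
  distinguishedRow-injective {zero}  {suc _}  ()
  distinguishedRow-injective {suc _} {zero}   ()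

  -- every row label occurs in W, so f is injective on all of them
  rowUsed : ∀ r → rowCode r ∈ Rows W
  rowUsed r with rowWitness r
  ... | t , w , refl = ∈-deduplicate⁺ _≟_ (∈-map⁺ rowOf (∈cellsOf⁺ w))

  embeddingForcesTorsionRank : EmbeddingForcesTorsionRank W (suc m)
  embeddingForcesTorsionRank G (f , h , k , f-injective , _ , _ , f+h≈k) rank gs generates =
    subst (_≤ 2 ^ rank) (length-tabulate t)
      (twoTorsionBound G rank gs generates (tabulate t)
        (All.tabulate⁺ order≤2-t) (AllPairs.tabulate⁺ distinct))
    where
    open AbelianGroup G renaming (ε to εᴳ; refl to ≈-refl; sym to ≈-sym; trans to ≈-trans)
    open import Algebra.Properties.AbelianGroup G using (∙-cancelʳ; ⁻¹-anti-homo‿-; ε⁻¹≈ε)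

    t : Fin (suc m) → Carrier
    t i = f (rowCode (distinguishedRow i)) ∙ f (rowCode P) ⁻¹

    relation : ∀ {r c s} → IsCell white (r , c , s) → f (rowCode r) ∙ h (colCode c) ≈ k (symCode s)
    relation w = f+h≈k _ _ _ (∈cellsOf⁺ w)

    order≤2-t : ∀ i → natMul G 2 (t i) ≈ εᴳ
    order≤2-t zero    = order≤2 G (inverseʳ (f (rowCode P))) (≈-trans (inverseʳ _) (≈-sym ε⁻¹≈ε))
    order≤2-t (suc j) = order≤2 G viaC (≈-trans viaD (≈-sym (⁻¹-anti-homo‿- _ _)))
      where
      viaC : t (suc j) ≈ k (symCode (S j)) ∙ k (symCode (E j)) ⁻¹
      viaC = ≈-trans (≈-sym (difference-cancelʳ G _ _ (h (colCode (C j)))))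
                     (∙-cong (relation (at j c₂)) (⁻¹-cong (relation (at j c₀))))
      viaD : t (suc j) ≈ k (symCode (E j)) ∙ k (symCode (S j)) ⁻¹
      viaD = ≈-trans (≈-sym (difference-cancelʳ G _ _ (h (colCode (D j)))))
                     (∙-cong (relation (at j c₃)) (⁻¹-cong (relation (at j c₁))))

    distinct : ∀ {i i′} → ¬ i ≡ i′ → ¬ t i ≈ t i′
    distinct {i} {i′} i≢i′ ti≈ti′ = i≢i′ (distinguishedRow-injective (rowCode-injective
      (f-injective _ _ (rowUsed (distinguishedRow i)) (rowUsed (distinguishedRow i′))
        (∙-cancelʳ _ _ _ ti≈ti′))))

corollary4p12 : (m : ℕ) → 2 ≤ m →
    Σω (List Triple) λ W → Σω (List Triple) λ B →
      (LatinBitrade W B × Planar W B × size W ≡ 8 * m) ×ω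
      EmbeddingForcesTorsionRank W (suc m)
corollary4p12 (suc (suc n)) (s≤s (s≤s z≤n)) =
  W ,ω (B ,ω ((latinBitrade , planar , size-W) ,ω' embeddingForcesTorsionRank))
  where open Construction n
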